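{- Let $\mathfrak{p}_2(n)$ denote the number of $2$-colored partitions of $n$, i.e. $\sum_{n\ge 0}\mathfrak{p}_2(n)q^n=\prod_{m\ge1}(1-q^m)^{ -2}$, with $\mathfrak{p}_2(m)=0$ for $m<0$. For $j\in\mathbb{Z}$ let $w_j=\frac{3j^2+j}{2}$ be the $j$-th pentagonal number and for $k\ge 0$ let $T_k=\frac{k^2+k}{2}$ be the $k$-th triangular number. Then for every positive integer $n$, $$ \mathfrak{p}_2(n)=\begin{cases} (-1)^j+\sum_{k\geq 1} (-1)^{k+1}(2k+1)\,\mathfrak{p}_2(n-T_k) & \text{ if } n=w_j \text{ for some } j\in\mathbb{Z},\\ \sum_{k\geq 1} (-1)^{k+1}(2k+1)\,\mathfrak{p}_2(n-T_k) & \text{ otherwise.} \end{cases} $$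
   Context: A $t$-colored partition of $n$ is a partition of $n$ in which each part may appear in one of $t$ colors. The pentagonal numbers $w_j$, $j\in\mathbb{Z}$, are pairwise distinct, so $j$ is determined by $n$ in the first case. -}

module Defs where

open import Data.Nat as ℕ using (ℕ; zero; suc; _≤?_)
open import Data.Nat.DivMod using (_/_)
open import Data.Integer as ℤ using (ℤ; +_; -[1+_]; ∣_∣)
open import Data.List using (List; []; _∷_; _++_; upTo; map; concatMap)
open import Data.Nat.ListAction using (sum)
open import Relation.Nullary using (yes; no)

-- Part types of equal size are distinct types (distinct colours).
ways : List ℕ → ℕ → ℕ
ways [] zero = 1
ways [] (suc _) = 0
ways (x ∷ xs) n = sum (map term (upTo (suc n)))
  where
  term : ℕ → ℕ
  term r with r ℕ.* x ≤? n
  ... | yes _ = ways xs (n ℕ.∸ r ℕ.* x)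
  ... | no _  = 0

colouredParts : ℕ → ℕ → List ℕ
colouredParts t n = concatMap (λ m → map (λ _ → suc m) (upTo t)) (upTo n)

colPartitions : ℕ → ℕ → ℕ
colPartitions t n = ways (colouredParts t n) n

p₂ : ℤ → ℤ
p₂ (+ n) = + colPartitions 2 n
p₂ -[1+ _ ] = + 0

-- pentagonal number w_j = (3j² + j)/2  (3j²+j ≥ 0 is even)
pent : ℤ → ℕ
pent j = ∣ + 3 ℤ.* j ℤ.* j ℤ.+ j ∣ / 2

tri : ℕ → ℕ
tri k = (k ℕ.* k ℕ.+ k) / 2

sgn : ℕ → ℤ
sgn k = (ℤ.- (+ 1)) ℤ.^ k

-- Σ_{k=1}^{n} (-1)^{k+1} (2k+1) 𝔭₂(n - T_k); terms with T_k > n vanish,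
-- and T_k > n for k > n, so this is the full sum over k ≥ 1.
rhsSum : ℕ → ℤ
rhsSum n = ℤSum (map (λ i → term (suc i)) (upTo n))
  where
  ℤSum : List ℤ → ℤ
  ℤSum [] = + 0
  ℤSum (x ∷ xs) = x ℤ.+ ℤSum xs
  term : ℕ → ℤ
  term k = sgn (suc k) ℤ.* (+ (2 ℕ.* k ℕ.+ 1)) ℤ.* p₂ (+ n ℤ.- + tri k)

-- A power series is handled through its coefficient sequence, on which 1 - q^a acts as the
-- difference operator ∇ a.  Jacobi's identity is proved by induction on n in the finite form
--   (q; q)ₙ³ = Σ_{k ≤ n} (-1)^k (2k+1) q^(T_k) (q; q)ₙ (q; q)_(2n+1) / ((q; q)_(n-k) (q; q)_(n+k+1)),
-- and Euler's pentagonal number theorem in Shanks' finite form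
--   Σ_{k ≤ n} (-1)^k q^(nk+T_k) (q; q)ₙ / (q; q)_k = Σ_{|j| ≤ n} (-1)^j q^(w_j).
-- Apply the first, with n = N, to the generating function of 2-coloured partitions into parts ≤ N:
-- (q; q)_N² turns it into 1, so the left side becomes (q; q)_N, whose coefficient of q^N is
-- [N = w_j] (-1)^j by the second identity.  On the right, the factors besides q^(T_k) only involve
-- powers q^i with i > N - T_k, so the coefficient of q^N is Σ_k (-1)^k (2k+1) 𝔭₂(N - T_k).

module Submission where

open import Defs
open import Data.Nat using (ℕ; suc)
open import Data.Integer using (ℤ; +_; _+_; ∣_∣)
open import Data.Product using (_×_; ∃)
open import Relation.Nullary using (¬_)
open import Relation.Binary.PropositionalEquality using (_≡_)

open import Data.Nat as ℕ using (zero; pred; _∸_; _≤_; _<_; _≤?_; z≤n; s≤s)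
import Data.Nat.Properties as ℕP
open import Data.Nat.DivMod using (_/_; m*n/n≡m)
open import Data.Nat.ListAction using (sum)
import Data.Nat.ListAction.Properties as SumP
open import Data.Integer as ℤ using (-[1+_]; _-_; _*_; -_; _⊖_)
import Data.Integer.Properties as ℤP
open import Data.List using (List; []; _∷_; _∷ʳ_; _++_; foldr; map; upTo; applyUpTo; concatMap)
import Data.List.Properties as ListP
open import Data.List.Relation.Unary.All as All using (All)
import Data.List.Relation.Unary.All.Properties as AllP
open import Data.Product using (Σ-syntax; _,_; proj₁; proj₂)
open import Data.Sum using (inj₁; inj₂; [_,_]′)
open import Data.Empty using (⊥-elim)
open import Function using (id; _∘_)
open import Relation.Nullary using (yes; no; Dec)
open import Relation.Binary.PropositionalEquality
  using (_≢_; _≗_; refl; sym; trans; cong; cong₂; cong-app; subst; module ≡-Reasoning; _→-setoid_)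
open import Relation.Binary.Bundles using (Setoid)
import Relation.Binary.Reasoning.Setoid as SetoidReasoning
open import Data.Nat.Tactic.RingSolver using () renaming (solve to ℕ-solve; solve-∀ to ℕ-solve-∀)
open import Data.Integer.Tactic.RingSolver using (solve-∀)

-- Σ_m f m q^m is represented by f; shift a multiplies by q^a and ∇ a by 1 - q^a.
Series : Set
Series = ℤ → ℤ

module ≗-Reasoning = SetoidReasoning (ℤ →-setoid ℤ)
open Setoid (ℤ →-setoid ℤ) using () renaming (refl to ≗-refl; sym to ≗-sym; trans to ≗-trans)

shift : ℕ → Series → Series
shift a f m = f (m - + a)

∇ : ℕ → Series → Series
∇ a f m = f m - f (m - + a)

infixl 6 _⊕_
_⊕_ : Series → Series → Series
(f ⊕ g) m = f m + g m

∇∏ : List ℕ → Series → Series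
∇∏ xs f = foldr ∇ f xs

range : ℕ → ℕ → List ℕ
range a zero    = []
range a (suc l) = a ∷ range (suc a) l

0ₛ : Series
0ₛ _ = + 0

cong-≗ : ∀ {I : Set} (F : I → Series) {x y} → x ≡ y → F x ≗ F y
cong-≗ F eq = cong-app (cong F eq)

cong₃ : ∀ {I R : Set} (h : I → I → I → R) {a a′ b b′ c c′} →
        a ≡ a′ → b ≡ b′ → c ≡ c′ → h a b c ≡ h a′ b′ c′
cong₃ h refl refl refl = refl

at-0 : ∀ (f : Series) m → f (m - + 0) ≡ f m
at-0 f m = cong f (ℤP.+-identityʳ m)

at-+ : ∀ (f : Series) m {a b c} → a ℕ.+ b ≡ c → f (m - + a - + b) ≡ f (m - + c)
at-+ f m {a} {b} refl = cong f (trans (assoc m (+ a) (+ b)) (cong (λ x → m - x) (sym (ℤP.pos-+ a b))))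
  where
  assoc : ∀ m x y → m - x - y ≡ m - (x + y)
  assoc = solve-∀

at-++ : ∀ (f : Series) m {a b c d} → a ℕ.+ b ℕ.+ c ≡ d → f (m - + a - + b - + c) ≡ f (m - + d)
at-++ f m {a} {b} eq = trans (cong (λ x → f (x - _)) (at-+ (λ x → x) m refl)) (at-+ f m eq)

at-+≡+ : ∀ (f : Series) m {a b c d} → a ℕ.+ b ≡ c ℕ.+ d → f (m - + a - + b) ≡ f (m - + c - + d)
at-+≡+ f m eq = trans (at-+ f m eq) (sym (at-+ f m refl))

∇-cong : ∀ a {f g} → f ≗ g → ∇ a f ≗ ∇ a g
∇-cong a f≗g m = cong₂ _-_ (f≗g m) (f≗g (m - + a))

shift-cong : ∀ a {f g} → f ≗ g → shift a f ≗ shift a g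
shift-cong a f≗g m = f≗g (m - + a)

⊕-cong : ∀ {f f′ g g′} → f ≗ f′ → g ≗ g′ → f ⊕ g ≗ f′ ⊕ g′
⊕-cong f≗f′ g≗g′ m = cong₂ _+_ (f≗f′ m) (g≗g′ m)

∇-comm : ∀ a b f → ∇ a (∇ b f) ≗ ∇ b (∇ a f)
∇-comm a b f m
  rewrite at-+ f m {a} {b} refl | at-+ f m {b} {a} (ℕP.+-comm b a)
  = swap (f m) (f (m - + b)) (f (m - + a)) (f (m - + (a ℕ.+ b)))
  where
  swap : ∀ w x y z → w - x - (y - z) ≡ w - y - (x - z)
  swap = solve-∀

∇-zero : ∀ f → ∇ 0 f ≗ 0ₛ
∇-zero f m rewrite at-0 f m = ℤP.+-inverseʳ (f m)

∇∏-cong : ∀ xs {f g} → f ≗ g → ∇∏ xs f ≗ ∇∏ xs g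
∇∏-cong []       f≗g = f≗g
∇∏-cong (x ∷ xs) f≗g = ∇-cong x (∇∏-cong xs f≗g)

∇∏-∇ : ∀ xs a f → ∇∏ xs (∇ a f) ≗ ∇ a (∇∏ xs f)
∇∏-∇ []       a f m = refl
∇∏-∇ (x ∷ xs) a f m = trans (∇-cong x (∇∏-∇ xs a f) m) (∇-comm x a (∇∏ xs f) m)

∇∏-∇² : ∀ xs a b f → ∇∏ xs (∇ a (∇ b f)) ≗ ∇ a (∇ b (∇∏ xs f))
∇∏-∇² xs a b f = ≗-trans (∇∏-∇ xs a (∇ b f)) (∇-cong a (∇∏-∇ xs b f))

∇∏-++ : ∀ xs ys f → ∇∏ (xs ++ ys) f ≗ ∇∏ xs (∇∏ ys f)
∇∏-++ xs ys f = cong-app (ListP.foldr-++ ∇ f xs ys)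

range-∷ʳ : ∀ a l → range a (suc l) ≡ range a l ++ (a ℕ.+ l) ∷ []
range-∷ʳ a zero    = cong (_∷ []) (sym (ℕP.+-identityʳ a))
range-∷ʳ a (suc l) = cong (a ∷_) (trans (range-∷ʳ (suc a) l) (cong (λ x → range (suc a) l ++ x ∷ []) (sym (ℕP.+-suc a l))))

∇∏-range-suc : ∀ a l f → ∇∏ (range a (suc l)) f ≗ ∇ (a ℕ.+ l) (∇∏ (range a l) f)
∇∏-range-suc a l f m = begin
  ∇∏ (range a (suc l)) f m                    ≡⟨ cong (λ xs → ∇∏ xs f m) (range-∷ʳ a l) ⟩
  ∇∏ (range a l ++ (a ℕ.+ l) ∷ []) f m        ≡⟨ ∇∏-++ (range a l) _ f m ⟩
  ∇∏ (range a l) (∇ (a ℕ.+ l) f) m           ≡⟨ ∇∏-∇ (range a l) (a ℕ.+ l) f m ⟩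
  ∇ (a ℕ.+ l) (∇∏ (range a l) f) m           ∎
  where open ≡-Reasoning

-- multiplication by (q; q)ₙ = (1 - q) ⋯ (1 - q^n)
pochhammer : ℕ → Series → Series
pochhammer n = ∇∏ (range 1 n)

pochhammer-suc : ∀ n f → pochhammer (suc n) f ≗ ∇ (suc n) (pochhammer n f)
pochhammer-suc n f = ∇∏-range-suc 1 n f

pochhammer-∇ : ∀ n a f → pochhammer n (∇ a f) ≗ ∇ a (pochhammer n f)
pochhammer-∇ n = ∇∏-∇ (range 1 n)

-- (1 - q^(c+2u)) = (1 - q^u)(1 + q^(c+u)) + q^u (1 - q^c)
∇-split : ∀ c u P → ∇ (c ℕ.+ u ℕ.+ u) P ≗ ∇ u P ⊕ shift (c ℕ.+ u) (∇ u P) ⊕ shift u (∇ c P)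
∇-split c u P m
  rewrite at-+ P m {c ℕ.+ u} {u} refl | at-+ P m {u} {c} (ℕP.+-comm u c)
  = ring (P m) (P (m - + (c ℕ.+ u))) (P (m - + (c ℕ.+ u ℕ.+ u))) (P (m - + u))
  where
  ring : ∀ x₀ x₁ x₂ x₃ → x₀ - x₂ ≡ x₀ - x₃ + (x₁ - x₂) + (x₃ - x₁)
  ring = solve-∀

-- mix u v w X Y Z is X (1 + q^u) + q^v Y + q^w Z, the shape of the recurrences below; it is opaque
-- so that unification can read its arguments off a goal.
opaque
  mix : ℕ → ℕ → ℕ → Series → Series → Series → Series
  mix u v w X Y Z = X ⊕ shift u X ⊕ shift v Y ⊕ shift w Z

  mix-cong : ∀ {u u′ v v′ w w′ X X′ Y Y′ Z Z′} → u ≡ u′ → v ≡ v′ → w ≡ w′ →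
             X ≗ X′ → Y ≗ Y′ → Z ≗ Z′ → mix u v w X Y Z ≗ mix u′ v′ w′ X′ Y′ Z′
  mix-cong refl refl refl X≗X′ Y≗Y′ Z≗Z′ =
    ⊕-cong (⊕-cong (⊕-cong X≗X′ (shift-cong _ X≗X′)) (shift-cong _ Y≗Y′)) (shift-cong _ Z≗Z′)

  ∇-mix : ∀ a u v w X Y Z → ∇ a (mix u v w X Y Z) ≗ mix u v w (∇ a X) (∇ a Y) (∇ a Z)
  ∇-mix a u v w X Y Z m
    rewrite at-+ X m {a} {u} refl | at-+ X m {u} {a} (ℕP.+-comm u a)
          | at-+ Y m {a} {v} refl | at-+ Y m {v} {a} (ℕP.+-comm v a)
          | at-+ Z m {a} {w} refl | at-+ Z m {w} {a} (ℕP.+-comm w a)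
    = ring (X m) (X (m - + a)) (X (m - + u)) (X (m - + (a ℕ.+ u))) (Y (m - + v)) (Y (m - + (a ℕ.+ v)))
           (Z (m - + w)) (Z (m - + (a ℕ.+ w)))
    where
    ring : ∀ x₀ x₁ x₂ x₃ y₀ y₁ z₀ z₁ →
      x₀ + x₂ + y₀ + z₀ - (x₁ + x₃ + y₁ + z₁) ≡ x₀ - x₁ + (x₂ - x₃) + (y₀ - y₁) + (z₀ - z₁)
    ring = solve-∀

  mix-at : ∀ u v w X Y Z m → mix u v w X Y Z m ≡ X m + X (m - + u) + Y (m - + v) + Z (m - + w)
  mix-at u v w X Y Z m = refl

  mix-0ₛ : ∀ u v w X Y → mix u v w X Y 0ₛ ≗ X ⊕ shift u X ⊕ shift v Y
  mix-0ₛ u v w X Y m = ℤP.+-identityʳ _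

  mix-0ₛ-0 : ∀ u w Y → mix u 0 w 0ₛ Y 0ₛ ≗ Y
  mix-0ₛ-0 u w Y m = trans (ring (Y (m - + 0))) (at-0 Y m)
    where
    ring : ∀ y → + 0 + + 0 + y + + 0 ≡ y
    ring = solve-∀

  -- with α = a + 1, β = b + 1: (1 - q^(α+β-1))(1 - q^(α+β))
  --   = (1 - q^α)(1 - q^β)(1 + q^(α+β-1)) + q^α (1 - q^(β-1))(1 - q^β) + q^β (1 - q^(α-1))(1 - q^α)
  ∇²-split : ∀ a b P →
    ∇ (suc a ℕ.+ suc b) (∇ (suc a ℕ.+ b) P) ≗
      mix (suc a ℕ.+ b) (suc a) (suc b) (∇ (suc a) (∇ (suc b) P)) (∇ b (∇ (suc b) P)) (∇ a (∇ (suc a) P))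
  ∇²-split a b P m
    rewrite at-+ P m {suc a ℕ.+ suc b} {suc a ℕ.+ b} refl
          | at-++ P m {suc a ℕ.+ b} {suc a} {suc b} {suc a ℕ.+ suc b ℕ.+ (suc a ℕ.+ b)} (ℕ-solve (a ∷ b ∷ []))
          | at-++ P m {suc a} {b} {suc b} {suc a ℕ.+ b ℕ.+ suc b} refl
          | at-++ P m {suc b} {a} {suc a} {suc a ℕ.+ b ℕ.+ suc a} (ℕ-solve (a ∷ b ∷ []))
          | at-+ P m {suc a} {suc b} refl
          | at-+ P m {suc b} {suc a} (ℕP.+-comm (suc b) (suc a))
          | at-+ P m {suc a} {b} refl
          | at-+ P m {suc b} {a} {suc a ℕ.+ b} (ℕ-solve (a ∷ b ∷ []))
          | at-+ P m {suc a ℕ.+ b} {suc b} refl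
          | at-+ P m {suc a ℕ.+ b} {suc a} refl
    = ring (P m) (P (m - + (suc a ℕ.+ b))) (P (m - + (suc a ℕ.+ suc b)))
           (P (m - + (suc a ℕ.+ suc b ℕ.+ (suc a ℕ.+ b)))) (P (m - + suc b)) (P (m - + suc a))
           (P (m - + (suc a ℕ.+ b ℕ.+ suc b))) (P (m - + (suc a ℕ.+ b ℕ.+ suc a)))
    where
    ring : ∀ p₀ p₁ p₂ p₃ pb pa q₁ q₂ →
      p₀ - p₁ - (p₂ - p₃) ≡
      p₀ - pb - (pa - p₂) + (p₁ - q₁ - (q₂ - p₃)) + (pa - p₂ - (p₁ - q₁)) + (pb - p₂ - (p₁ - q₂))
    ring = solve-∀

PowerSeries : Series → Set
PowerSeries g = ∀ k → g -[1+ k ] ≡ + 0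

negative-point : ∀ p d → + p - + (suc p ℕ.+ d) ≡ -[1+ d ]
negative-point zero    d = refl
negative-point (suc p) d = begin
  + suc p - + suc (suc p ℕ.+ d)  ≡⟨ ℤP.m-n≡m⊖n (suc p) (suc (suc p ℕ.+ d)) ⟩
  suc p ⊖ suc (suc p ℕ.+ d)      ≡⟨ ℤP.[1+m]⊖[1+n]≡m⊖n p (suc p ℕ.+ d) ⟩
  p ⊖ (suc p ℕ.+ d)              ≡⟨ ℤP.m-n≡m⊖n p (suc p ℕ.+ d) ⟨
  + p - + (suc p ℕ.+ d)          ≡⟨ negative-point p d ⟩
  -[1+ d ]                       ∎
  where open ≡-Reasoning

PowerSeries-below : ∀ {g} → PowerSeries g → ∀ {p c} → p < c → g (+ p - + c) ≡ + 0
PowerSeries-below {g} g₋≡0 {p} {c} p<c =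
  trans (cong (λ c → g (+ p - + c)) (sym (ℕP.m+[n∸m]≡n p<c))) (trans (cong g (negative-point p (c ∸ suc p))) (g₋≡0 _))

∇-PowerSeries : ∀ a {g} → PowerSeries g → PowerSeries (∇ a g)
∇-PowerSeries zero    g₋≡0 k rewrite g₋≡0 k = refl
∇-PowerSeries (suc a) g₋≡0 k rewrite g₋≡0 k | g₋≡0 (suc (k ℕ.+ a)) = refl

∇∏-PowerSeries : ∀ xs {g} → PowerSeries g → PowerSeries (∇∏ xs g)
∇∏-PowerSeries []       g₋≡0 = g₋≡0
∇∏-PowerSeries (x ∷ xs) {g} g₋≡0 = ∇-PowerSeries x {∇∏ xs g} (∇∏-PowerSeries xs g₋≡0)

∇∏-range-below : ∀ {g} → PowerSeries g → ∀ a l {p} → p < a → ∇∏ (range a l) g (+ p) ≡ g (+ p)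
∇∏-range-below g₋≡0 a zero    p<a = refl
∇∏-range-below {g} g₋≡0 a (suc l) {p} p<a =
  trans (cong (λ z → h (+ p) - z) (PowerSeries-below {h} (∇∏-PowerSeries (range (suc a) l) g₋≡0) p<a))
        (trans (ℤP.+-identityʳ _) (∇∏-range-below g₋≡0 (suc a) l (ℕP.m<n⇒m<1+n p<a)))
  where
  h = ∇∏ (range (suc a) l) g

Σ : ℕ → (ℕ → ℤ) → ℤ
Σ zero    g = + 0
Σ (suc n) g = Σ n g + g n

Σ-cong : ∀ n {g h} → (∀ k → k < n → g k ≡ h k) → Σ n g ≡ Σ n h
Σ-cong zero    g≡h = refl
Σ-cong (suc n) g≡h = cong₂ _+_ (Σ-cong n (λ k k<n → g≡h k (ℕP.m<n⇒m<1+n k<n))) (g≡h n (ℕP.n<1+n n))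

Σ-+ : ∀ n g h → Σ n (λ k → g k + h k) ≡ Σ n g + Σ n h
Σ-+ zero    g h = refl
Σ-+ (suc n) g h = trans (cong (_+ (g n + h n)) (Σ-+ n g h)) (ring (Σ n g) (Σ n h) (g n) (h n))
  where
  ring : ∀ a b c d → a + b + (c + d) ≡ a + c + (b + d)
  ring = solve-∀

Σ-- : ∀ n g h → Σ n (λ k → g k - h k) ≡ Σ n g - Σ n h
Σ-- zero    g h = refl
Σ-- (suc n) g h = trans (cong (_+ (g n - h n)) (Σ-- n g h)) (ring (Σ n g) (Σ n h) (g n) (h n))
  where
  ring : ∀ a b c d → a - b + (c - d) ≡ a + c - (b + d)
  ring = solve-∀

Σ-neg : ∀ n h → Σ n (λ i → - h i) ≡ - Σ n h
Σ-neg zero    h = refl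
Σ-neg (suc n) h = trans (cong (_+ - h n) (Σ-neg n h)) (sym (ℤP.neg-distrib-+ (Σ n h) (h n)))

Σ-zero : ∀ n g → (∀ k → g k ≡ + 0) → Σ n g ≡ + 0
Σ-zero zero    g g≡0 = refl
Σ-zero (suc n) g g≡0 = cong₂ _+_ (Σ-zero n g g≡0) (g≡0 n)

Σ-suc : ∀ n g → Σ (suc n) g ≡ g 0 + Σ n (g ∘ suc)
Σ-suc zero    g = ℤP.+-comm (+ 0) (g 0)
Σ-suc (suc n) g = trans (cong (_+ g (suc n)) (Σ-suc n g)) (ℤP.+-assoc (g 0) _ _)

Σ-telescope : ∀ L (a b : ℕ → ℤ) → Σ L (λ k → a k - b k + b (suc k)) ≡ Σ L a - b 0 + b L
Σ-telescope zero    a b = sym (trans (cong (_+ b 0) (ℤP.+-identityˡ (- b 0))) (ℤP.+-inverseˡ (b 0)))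
Σ-telescope (suc L) a b = trans (cong (_+ (a L - b L + b (suc L))) (Σ-telescope L a b)) (ring (Σ L a) (a L) (b 0) (b L) (b (suc L)))
  where
  ring : ∀ s x p q r → s - p + q + (x - q + r) ≡ s + x - p + r
  ring = solve-∀

Σ-applyUpTo : ∀ {S : List ℕ → ℤ} (F : ℕ → ℤ) → S [] ≡ + 0 → (∀ i is → S (i ∷ is) ≡ F i + S is) →
              ∀ n f → S (applyUpTo f n) ≡ Σ n (F ∘ f)
Σ-applyUpTo F S[]≡0 S-∷ zero    f = S[]≡0
Σ-applyUpTo F S[]≡0 S-∷ (suc n) f =
  trans (S-∷ (f 0) _) (trans (cong (λ z → F (f 0) + z) (Σ-applyUpTo F S[]≡0 S-∷ n (f ∘ suc))) (sym (Σ-suc n (F ∘ f))))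

weight : ℕ → ℤ
weight k = + (2 ℕ.* k ℕ.+ 1)

weight-suc : ∀ k → weight (suc k) ≡ weight k + + 2
weight-suc k = trans (cong +_ 2k+3) (ℤP.pos-+ (2 ℕ.* k ℕ.+ 1) 2)
  where
  2k+3 : 2 ℕ.* suc k ℕ.+ 1 ≡ 2 ℕ.* k ℕ.+ 1 ℕ.+ 2
  2k+3 = ℕ-solve (k ∷ [])

-- c (k - 1), where c (-1) = - c 0: jacobiTerm n k below is odd under k ↦ -1 - k
before : (ℕ → ℤ) → ℕ → ℤ
before c zero    = - c 0
before c (suc k) = c k

Σ-weight-neighbours : ∀ (c : ℕ → ℤ) L →
  Σ (suc L) (λ k → weight k * (before c k + c (suc k))) ≡
  + 2 * Σ (suc L) (λ k → weight k * c k) - weight (suc L) * c L + weight L * c (suc L)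
Σ-weight-neighbours c zero = ring (c 0) (c 1)
  where
  ring : ∀ x y → + 0 + + 1 * (- x + y) ≡ + 2 * (+ 0 + + 1 * x) - + 3 * x + + 1 * y
  ring = solve-∀
Σ-weight-neighbours c (suc L) = begin
  Σ (suc L) (λ k → weight k * (before c k + c (suc k))) + weight (suc L) * (c L + c (suc (suc L)))
    ≡⟨ cong (_+ weight (suc L) * (c L + c (suc (suc L)))) (Σ-weight-neighbours c L) ⟩
  + 2 * S - weight (suc L) * c L + weight L * c (suc L) + weight (suc L) * (c L + c (suc (suc L)))
    ≡⟨ cong (λ u → + 2 * S - u * c L + weight L * c (suc L) + u * (c L + c (suc (suc L)))) (weight-suc L) ⟩
  + 2 * S - (weight L + + 2) * c L + weight L * c (suc L) + (weight L + + 2) * (c L + c (suc (suc L)))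
    ≡⟨ ring S (weight L) (c L) (c (suc L)) (c (suc (suc L))) ⟩
  + 2 * (S + (weight L + + 2) * c (suc L)) - (weight L + + 2 + + 2) * c (suc L) + (weight L + + 2) * c (suc (suc L))
    ≡⟨ cong₂ (λ u v → + 2 * (S + u * c (suc L)) - v * c (suc L) + u * c (suc (suc L)))
             (sym (weight-suc L)) (sym (trans (weight-suc (suc L)) (cong (_+ + 2) (weight-suc L)))) ⟩
  + 2 * (S + weight (suc L) * c (suc L)) - weight (suc (suc L)) * c (suc L) + weight (suc L) * c (suc (suc L))  ∎
  where
  open ≡-Reasoning
  S = Σ (suc L) (λ k → weight k * c k)
  ring : ∀ S w x y z → + 2 * S - (w + + 2) * x + w * y + (w + + 2) * (x + z) ≡
                      + 2 * (S + (w + + 2) * y) - (w + + 2 + + 2) * y + (w + + 2) * z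
  ring = solve-∀

-- A finite form of Jacobi's identity

triangular : ℕ → ℕ
triangular zero    = 0
triangular (suc k) = triangular k ℕ.+ suc k

triangular-double : ∀ k → triangular k ℕ.* 2 ≡ k ℕ.* k ℕ.+ k
triangular-double zero    = refl
triangular-double (suc k) = begin
  (triangular k ℕ.+ suc k) ℕ.* 2      ≡⟨ ℕP.*-distribʳ-+ 2 (triangular k) (suc k) ⟩
  triangular k ℕ.* 2 ℕ.+ suc k ℕ.* 2  ≡⟨ cong (ℕ._+ suc k ℕ.* 2) (triangular-double k) ⟩
  k ℕ.* k ℕ.+ k ℕ.+ suc k ℕ.* 2       ≡⟨ ℕ-solve (k ∷ []) ⟩
  suc k ℕ.* suc k ℕ.+ suc k           ∎
  where open ≡-Reasoning

triangular-≥ : ∀ k → k ≤ triangular k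
triangular-≥ zero    = z≤n
triangular-≥ (suc k) = ℕP.m≤n+m (suc k) (triangular k)

-- jacobiFactor n k multiplies by (1 - q^(n-k+1)) ⋯ (1 - q^n) ⋅ (1 - q^(n+k+2)) ⋯ (1 - q^(2n+1)).
-- For k > n the first range starts at 0 (truncated subtraction), so the factor vanishes.
jacobiFactor : ℕ → ℕ → Series → Series
jacobiFactor n k f = ∇∏ (range (suc n ∸ k) k) (∇∏ (range (suc n ℕ.+ suc k) (n ∸ k)) f)

-- At k = 0 the term for k - 1 is jacobiFactor n 0, as the factor is symmetric under k ↦ -1 - k;
-- pred 0 = 0 provides exactly this.
jacobiFactor-rhs : ℕ → ℕ → Series → Series
jacobiFactor-rhs n k f =
  mix (suc n ℕ.+ suc n) (suc n ∸ k) (suc n ℕ.+ suc k) (jacobiFactor n k f) (jacobiFactor n (pred k) f) (jacobiFactor n (suc k) f)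

FactorRecurrence : ℕ → ℕ → Series → Set
FactorRecurrence n k f = jacobiFactor (suc n) k f ≗ ∇ (suc n) (jacobiFactor-rhs n k f)

jacobiFactor-vanishes : ∀ n k f → n < k → jacobiFactor n k f ≗ 0ₛ
jacobiFactor-vanishes n (suc k) f (s≤s n≤k) rewrite ℕP.m≤n⇒m∸n≡0 n≤k =
  ∇-zero (∇∏ (range 1 k) (∇∏ (range (suc n ℕ.+ suc (suc k)) (n ∸ suc k)) f))

jacobiFactor-as : ∀ {n} k j f → k ℕ.+ j ≡ n →
                  jacobiFactor n k f ≗ ∇∏ (range (suc j) k) (∇∏ (range (suc n ℕ.+ suc k) j) f)
jacobiFactor-as k j f refl = cong-app (cong₂ (λ s l → ∇∏ (range s k) (∇∏ (range (suc (k ℕ.+ j) ℕ.+ suc k) l) f))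
  (trans (cong (_∸ k) (sym (ℕP.+-suc k j))) (ℕP.m+n∸m≡n k (suc j))) (ℕP.m+n∸m≡n k j))

jacobiFactor-suc-top : ∀ n f → FactorRecurrence n (suc n) f
jacobiFactor-suc-top n f = begin
  jacobiFactor (suc n) (suc n) f            ≈⟨ jacobiFactor-as (suc n) 0 f (ℕP.+-identityʳ (suc n)) ⟩
  ∇∏ (range 1 (suc n)) f                    ≈⟨ ∇∏-range-suc 1 n f ⟩
  ∇ (suc n) (∇∏ (range 1 n) f)              ≈⟨ ∇-cong (suc n) rhs ⟨
  ∇ (suc n) (jacobiFactor-rhs n (suc n) f)  ∎
  where
  open ≗-Reasoning
  rhs : jacobiFactor-rhs n (suc n) f ≗ ∇∏ (range 1 n) f
  rhs = ≗-trans (mix-cong refl (ℕP.n∸n≡0 n) refl (jacobiFactor-vanishes n (suc n) f (ℕP.n<1+n n))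
                          (jacobiFactor-as n 0 f (ℕP.+-identityʳ n))
                          (jacobiFactor-vanishes n (suc (suc n)) f (ℕP.m<n⇒m<1+n (ℕP.n<1+n n))))
                (mix-0ₛ-0 _ _ _)

jacobiFactor-suc-diagonal : ∀ a f → FactorRecurrence (suc a) (suc a) f
jacobiFactor-suc-diagonal a f = begin
  jacobiFactor (suc n) n f                     ≈⟨ jacobiFactor-as n 1 f (ℕP.+-comm n 1) ⟩
  ∇∏ (range 2 n) (∇ (suc (suc n) ℕ.+ suc n) f)  ≈⟨ ∇∏-range-suc 2 a _ ⟩
  ∇ (suc n) (∇∏ (range 2 a) (∇ (suc (suc n) ℕ.+ suc n) f))
    ≈⟨ ∇-cong (suc n) (∇∏-∇ (range 2 a) _ f) ⟩
  ∇ (suc n) (∇ (suc (suc n) ℕ.+ suc n) C)      ≈⟨ ∇-cong (suc n) (cong-≗ (λ x → ∇ x C) 2n+3) ⟩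
  ∇ (suc n) (∇ (c ℕ.+ 1 ℕ.+ 1) C)              ≈⟨ ∇-cong (suc n) (∇-split c 1 C) ⟩
  ∇ (suc n) (∇ 1 C ⊕ shift (c ℕ.+ 1) (∇ 1 C) ⊕ shift 1 (∇ c C))
    ≈⟨ ∇-cong (suc n) rhs ⟨
  ∇ (suc n) (jacobiFactor-rhs n n f)           ∎
  where
  open ≗-Reasoning
  n = suc a
  c = suc (suc a) ℕ.+ suc a
  C = ∇∏ (range 2 a) f
  2n+3 : suc (suc (suc a)) ℕ.+ suc (suc a) ≡ suc (suc a) ℕ.+ suc a ℕ.+ 1 ℕ.+ 1
  2n+3 = ℕ-solve (a ∷ [])
  2n+2 : suc (suc a) ℕ.+ suc (suc a) ≡ suc (suc a) ℕ.+ suc a ℕ.+ 1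
  2n+2 = ℕ-solve (a ∷ [])
  rhs : jacobiFactor-rhs n n f ≗ ∇ 1 C ⊕ shift (c ℕ.+ 1) (∇ 1 C) ⊕ shift 1 (∇ c C)
  rhs = begin
    jacobiFactor-rhs n n f
      ≈⟨ mix-cong 2n+2 (ℕP.m+n∸n≡m 1 a) refl (jacobiFactor-as n 0 f (ℕP.+-identityʳ n))
                  (≗-trans (jacobiFactor-as a 1 f (ℕP.+-comm a 1)) (∇∏-∇ (range 2 a) c f))
                  (jacobiFactor-vanishes n (suc n) f (ℕP.n<1+n n)) ⟩
    mix (c ℕ.+ 1) 1 (suc n ℕ.+ suc n) (∇ 1 C) (∇ c C) 0ₛ
      ≈⟨ mix-0ₛ (c ℕ.+ 1) 1 (suc n ℕ.+ suc n) (∇ 1 C) (∇ c C) ⟩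
    ∇ 1 C ⊕ shift (c ℕ.+ 1) (∇ 1 C) ⊕ shift 1 (∇ c C)  ∎

jacobiFactor-suc-origin : ∀ f → FactorRecurrence 0 0 f
jacobiFactor-suc-origin f = begin
  jacobiFactor 1 0 f                         ≈⟨ ∇-split 1 1 f ⟩
  ∇ 1 f ⊕ shift 2 (∇ 1 f) ⊕ shift 1 (∇ 1 f)  ≈⟨ mix-0ₛ 2 1 2 (∇ 1 f) (∇ 1 f) ⟨
  mix 2 1 2 (∇ 1 f) (∇ 1 f) (∇ 1 0ₛ)         ≈⟨ ∇-mix 1 2 1 2 f f 0ₛ ⟨
  ∇ 1 (mix 2 1 2 f f 0ₛ)                     ≈⟨ ∇-cong 1 (mix-cong refl refl refl ≗-refl ≗-refl vanishes) ⟨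
  ∇ 1 (jacobiFactor-rhs 0 0 f)               ∎
  where
  open ≗-Reasoning
  vanishes = jacobiFactor-vanishes 0 1 f (s≤s z≤n)

jacobiFactor-suc-base : ∀ a f → FactorRecurrence (suc a) 0 f
jacobiFactor-suc-base a f = begin
  jacobiFactor (suc n) 0 f                         ≈⟨ ∇∏-range-suc s n f ⟩
  ∇ (s ℕ.+ n) (∇∏ (range s n) f)                   ≈⟨ ∇-cong _ (∇∏-range-suc s a f) ⟩
  ∇ (s ℕ.+ n) (∇ (s ℕ.+ a) C)                      ≈⟨ cong-app (cong₂ (λ x y → ∇ x (∇ y C)) 2n+3 2n+2) ⟩
  ∇ (suc n ℕ.+ suc (suc n)) (∇ (suc n ℕ.+ suc n) C) ≈⟨ ∇²-split n (suc n) C ⟩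
  mix (suc n ℕ.+ suc n) (suc n) (suc (suc n)) X X (∇ n (∇ (suc n) C))
    ≈⟨ mix-cong refl refl refl ≗-refl ≗-refl (∇-comm n (suc n) C) ⟩
  mix (suc n ℕ.+ suc n) (suc n) (suc (suc n)) X X (∇ (suc n) (∇ n C))
    ≈⟨ ∇-mix (suc n) _ _ _ (∇ (suc (suc n)) C) (∇ (suc (suc n)) C) (∇ n C) ⟨
  ∇ (suc n) (mix (suc n ℕ.+ suc n) (suc n) (suc (suc n)) (∇ (suc (suc n)) C) (∇ (suc (suc n)) C) (∇ n C))
    ≈⟨ ∇-cong (suc n) (mix-cong refl refl n+2 at-k at-k at-k+1) ⟨
  ∇ (suc n) (jacobiFactor-rhs n 0 f)               ∎
  where
  open ≗-Reasoning
  n = suc a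
  s = suc (suc n) ℕ.+ 1
  C = ∇∏ (range s a) f
  X = ∇ (suc n) (∇ (suc (suc n)) C)
  2n+3 : suc (suc (suc a)) ℕ.+ 1 ℕ.+ suc a ≡ suc (suc a) ℕ.+ suc (suc (suc a))
  2n+3 = ℕ-solve (a ∷ [])
  2n+2 : suc (suc (suc a)) ℕ.+ 1 ℕ.+ a ≡ suc (suc a) ℕ.+ suc (suc a)
  2n+2 = ℕ-solve (a ∷ [])
  n+2 : suc (suc a) ℕ.+ 1 ≡ suc (suc (suc a))
  n+2 = ℕ-solve (a ∷ [])
  n+4 : suc (suc a) ℕ.+ 2 ≡ suc (suc (suc a)) ℕ.+ 1
  n+4 = ℕ-solve (a ∷ [])
  at-k : jacobiFactor n 0 f ≗ ∇ (suc (suc n)) C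
  at-k = cong-≗ (λ x → ∇ x C) n+2
  at-k+1 : jacobiFactor n 1 f ≗ ∇ n C
  at-k+1 = cong-≗ (λ x → ∇ n (∇∏ (range x a) f)) n+4

-- For k = a + 1 < n = a + b + 2, the factors of jacobiFactor n (k - 1), n k, n (k + 1) and (n + 1) k
-- common to all four: those indexed by range (b + 3) a and range (2a + b + 6) b.
interiorCore : ℕ → ℕ → Series → Series
interiorCore a b f = ∇∏ (range (suc (suc (suc b))) a) (∇∏ (range (suc (suc (suc a ℕ.+ suc b)) ℕ.+ suc (suc a)) b) f)

jacobiFactor-rhs-interior : ∀ a b f →
  let β = suc a ℕ.+ suc b ℕ.+ suc (suc a); C = interiorCore a b f in
  jacobiFactor-rhs (suc a ℕ.+ suc b) (suc a) f ≗
    mix (suc (suc b) ℕ.+ β) (suc (suc b)) (suc β) (∇ (suc (suc b)) (∇ (suc β) C)) (∇ β (∇ (suc β) C))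
        (∇ (suc b) (∇ (suc (suc b)) C))
jacobiFactor-rhs-interior a b f = mix-cong 2n+2 n-k+1 refl at-k at-k-1 at-k+1
  where
  open ≗-Reasoning
  n = suc a ℕ.+ suc b
  β = suc a ℕ.+ suc b ℕ.+ suc (suc a)
  R = range (suc (suc (suc b))) a
  Q = ∇∏ (range (suc (suc n) ℕ.+ suc (suc a)) b) f
  C = interiorCore a b f
  2n+2 : suc (suc a ℕ.+ suc b) ℕ.+ suc (suc a ℕ.+ suc b) ≡ suc (suc b) ℕ.+ (suc a ℕ.+ suc b ℕ.+ suc (suc a))
  2n+2 = ℕ-solve (a ∷ b ∷ [])
  n-k+1 : suc (suc a ℕ.+ suc b) ∸ suc a ≡ suc (suc b)
  n-k+1 = trans (cong (_∸ a) (sym (ℕP.+-suc a (suc b)))) (ℕP.m+n∸m≡n a (suc (suc b)))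
  at-k : jacobiFactor n (suc a) f ≗ ∇ (suc (suc b)) (∇ (suc β) C)
  at-k = ≗-trans (jacobiFactor-as (suc a) (suc b) f refl) (∇-cong (suc (suc b)) (∇∏-∇ R (suc β) Q))
  at-k-1 : jacobiFactor n a f ≗ ∇ β (∇ (suc β) C)
  at-k-1 = begin
    jacobiFactor n a f
      ≈⟨ jacobiFactor-as a (suc (suc b)) f (ℕP.+-suc a (suc b)) ⟩
    ∇∏ R (∇ (suc n ℕ.+ suc a) (∇ (suc (suc n ℕ.+ suc a)) (∇∏ (range (suc (suc (suc n ℕ.+ suc a))) b) f)))
      ≈⟨ cong-≗ (λ x → ∇∏ R (∇ x (∇ (suc x) (∇∏ (range (suc (suc x)) b) f)))) (ℕP.+-suc n (suc a)) ⟨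
    ∇∏ R (∇ β (∇ (suc β) Q))
      ≈⟨ ∇∏-∇² R β (suc β) Q ⟩
    ∇ β (∇ (suc β) C)  ∎
  at-k+1 : jacobiFactor n (suc (suc a)) f ≗ ∇ (suc b) (∇ (suc (suc b)) C)
  at-k+1 = ≗-trans (jacobiFactor-as (suc (suc a)) b f (cong suc (sym (ℕP.+-suc a b))))
    (cong-≗ (λ x → ∇ (suc b) (∇ (suc (suc b)) (∇∏ R (∇∏ (range x b) f)))) (cong suc (ℕP.+-suc n (suc (suc a)))))

jacobiFactor-suc-interior : ∀ a b f → FactorRecurrence (suc a ℕ.+ suc b) (suc a) f
jacobiFactor-suc-interior a b f = begin
  jacobiFactor (suc n) (suc a) f
    ≈⟨ jacobiFactor-as (suc a) (suc (suc b)) f (ℕP.+-suc (suc a) (suc b)) ⟩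
  ∇∏ (range (suc (suc (suc b))) (suc a)) (∇∏ (range s₀ (suc (suc b))) f)
    ≈⟨ ∇∏-range-suc (suc (suc (suc b))) a _ ⟩
  ∇ (suc (suc (suc b)) ℕ.+ a) (∇∏ R (∇∏ (range s₀ (suc (suc b))) f))
    ≈⟨ ∇-cong _ (∇∏-cong R (≗-trans (∇∏-range-suc s₀ (suc b) f) (∇-cong _ (∇∏-range-suc s₀ b f)))) ⟩
  ∇ (suc (suc (suc b)) ℕ.+ a) (∇∏ R (∇ (s₀ ℕ.+ suc b) (∇ (s₀ ℕ.+ b) Q)))
    ≈⟨ ∇-cong _ (∇∏-∇² R _ _ Q) ⟩
  ∇ (suc (suc (suc b)) ℕ.+ a) (∇ (s₀ ℕ.+ suc b) (∇ (s₀ ℕ.+ b) C))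
    ≈⟨ cong-app (cong₃ (λ x y z → ∇ x (∇ y (∇ z C))) n+1 2n+3 2n+2) ⟩
  ∇ (suc n) (∇ (suc (suc b) ℕ.+ suc β) (∇ (suc (suc b) ℕ.+ β) C))
    ≈⟨ ∇-cong (suc n) (∇²-split (suc b) β C) ⟩
  ∇ (suc n) (mix (suc (suc b) ℕ.+ β) (suc (suc b)) (suc β)
                 (∇ (suc (suc b)) (∇ (suc β) C)) (∇ β (∇ (suc β) C)) (∇ (suc b) (∇ (suc (suc b)) C)))
    ≈⟨ ∇-cong (suc n) (jacobiFactor-rhs-interior a b f) ⟨
  ∇ (suc n) (jacobiFactor-rhs n (suc a) f)  ∎
  where
  open ≗-Reasoning
  n = suc a ℕ.+ suc b
  β = suc a ℕ.+ suc b ℕ.+ suc (suc a)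
  s₀ = suc (suc n) ℕ.+ suc (suc a)
  R = range (suc (suc (suc b))) a
  Q = ∇∏ (range s₀ b) f
  C = interiorCore a b f
  n+1 : suc (suc (suc b)) ℕ.+ a ≡ suc (suc a ℕ.+ suc b)
  n+1 = ℕ-solve (a ∷ b ∷ [])
  2n+3 : suc (suc (suc a ℕ.+ suc b)) ℕ.+ suc (suc a) ℕ.+ suc b ≡ suc (suc b) ℕ.+ suc (suc a ℕ.+ suc b ℕ.+ suc (suc a))
  2n+3 = ℕ-solve (a ∷ b ∷ [])
  2n+2 : suc (suc (suc a ℕ.+ suc b)) ℕ.+ suc (suc a) ℕ.+ b ≡ suc (suc b) ℕ.+ (suc a ℕ.+ suc b ℕ.+ suc (suc a))
  2n+2 = ℕ-solve (a ∷ b ∷ [])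

jacobiFactor-suc : ∀ n k f → k ≤ suc n → FactorRecurrence n k f
jacobiFactor-suc zero    zero    f _         = jacobiFactor-suc-origin f
jacobiFactor-suc (suc a) zero    f _         = jacobiFactor-suc-base a f
jacobiFactor-suc n       (suc k) f (s≤s k≤n) = subst (P k) (ℕP.m+[n∸m]≡n k≤n) (above k (n ∸ k))
  where
  P : ℕ → ℕ → Set
  P k n = FactorRecurrence n (suc k) f
  above : ∀ k j → P k (k ℕ.+ j)
  above k zero          = subst (P k) (sym (ℕP.+-identityʳ k)) (jacobiFactor-suc-top k f)
  above k (suc zero)    = subst (P k) (ℕP.+-comm 1 k) (jacobiFactor-suc-diagonal k f)
  above k (suc (suc b)) = subst (P k) (sym (ℕP.+-suc k (suc b))) (jacobiFactor-suc-interior k b f)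

jacobiTerm : ℕ → ℕ → Series → Series
jacobiTerm n k f m = sgn k * jacobiFactor n k f (m - + triangular k)

jacobiTerm-vanishes : ∀ n k f m → n < k → jacobiTerm n k f m ≡ + 0
jacobiTerm-vanishes n k f m n<k = trans (cong (sgn k *_) (jacobiFactor-vanishes n k f n<k _)) (ℤP.*-zeroʳ (sgn k))

jacobiTerm-rhs : ℕ → ℕ → Series → Series
jacobiTerm-rhs n k f x =
  jacobiTerm n k f x + jacobiTerm n k f (x - + (suc n ℕ.+ suc n))
  - (before (λ j → jacobiTerm n j f (x - + suc n)) k + jacobiTerm n (suc k) f (x - + suc n))

jacobiTerm-rhs-expand : ∀ n k f x → k ≤ suc n →
                        jacobiTerm-rhs n k f x ≡ sgn k * jacobiFactor-rhs n k f (x - + triangular k)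
jacobiTerm-rhs-expand n zero f x _ = begin
  jacobiTerm-rhs n 0 f x
    ≡⟨ cong₃ (λ u v w → + 1 * X (x - + 0) + + 1 * u - (- (+ 1 * v) + sgn 1 * w))
             (at-+≡+ X x {c = 0} (ℕP.+-comm (M ℕ.+ M) 0)) (at-+≡+ X x {c = 0} (ℕP.+-comm M 0))
             (at-+≡+ Z x {M} {1} {0} refl) ⟩
  + 1 * X (x - + 0) + + 1 * X (x - + 0 - + (M ℕ.+ M)) - (- (+ 1 * X (x - + 0 - + M)) + sgn 1 * Z (x - + 0 - + (M ℕ.+ 1)))
    ≡⟨ ring (X (x - + 0)) (X (x - + 0 - + (M ℕ.+ M))) (X (x - + 0 - + M)) (Z (x - + 0 - + (M ℕ.+ 1))) ⟩
  + 1 * (X (x - + 0) + X (x - + 0 - + (M ℕ.+ M)) + X (x - + 0 - + M) + Z (x - + 0 - + (M ℕ.+ 1)))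
    ≡⟨ cong (+ 1 *_) (mix-at _ _ _ X X Z (x - + 0)) ⟨
  + 1 * jacobiFactor-rhs n 0 f (x - + 0)  ∎
  where
  open ≡-Reasoning
  M = suc n
  X = jacobiFactor n 0 f
  Z = jacobiFactor n 1 f
  ring : ∀ a b c d → + 1 * a + + 1 * b - (- (+ 1 * c) + -[1+ 0 ] * d) ≡ + 1 * (a + b + c + d)
  ring = solve-∀
jacobiTerm-rhs-expand n (suc k) f x (s≤s k≤n) = begin
  jacobiTerm-rhs n (suc k) f x
    ≡⟨ cong₃ (λ u v w → sgn (suc k) * X (x - + t) + sgn (suc k) * u - (sgn k * v + sgn (suc (suc k)) * w))
             (at-+≡+ X x (ℕP.+-comm (M ℕ.+ M) t)) (at-+≡+ Y x below) (at-+≡+ Z x (above M t k)) ⟩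
  sgn (suc k) * X (x - + t) + sgn (suc k) * X (x - + t - + (M ℕ.+ M))
    - (sgn k * Y (x - + t - + (M ∸ suc k)) + sgn (suc (suc k)) * Z (x - + t - + (M ℕ.+ suc (suc k))))
    ≡⟨ ring (sgn k) (X (x - + t)) (X (x - + t - + (M ℕ.+ M))) (Y (x - + t - + (M ∸ suc k))) (Z (x - + t - + (M ℕ.+ suc (suc k)))) ⟩
  sgn (suc k) * (X (x - + t) + X (x - + t - + (M ℕ.+ M)) + Y (x - + t - + (M ∸ suc k)) + Z (x - + t - + (M ℕ.+ suc (suc k))))
    ≡⟨ cong (sgn (suc k) *_) (mix-at _ _ _ X Y Z (x - + t)) ⟨
  sgn (suc k) * jacobiFactor-rhs n (suc k) f (x - + t)  ∎
  where
  open ≡-Reasoning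
  M = suc n
  t = triangular (suc k)
  X = jacobiFactor n (suc k) f
  Y = jacobiFactor n k f
  Z = jacobiFactor n (suc (suc k)) f
  rotate : ∀ a b c → a ℕ.+ b ℕ.+ c ≡ c ℕ.+ a ℕ.+ b
  rotate = ℕ-solve-∀
  below : suc n ℕ.+ triangular k ≡ triangular k ℕ.+ suc k ℕ.+ (suc n ∸ suc k)
  below = trans (cong (ℕ._+ triangular k) (sym (ℕP.m+[n∸m]≡n (s≤s k≤n)))) (rotate (suc k) (suc n ∸ suc k) (triangular k))
  above : ∀ m t k → m ℕ.+ (t ℕ.+ suc (suc k)) ≡ t ℕ.+ (m ℕ.+ suc (suc k))
  above = ℕ-solve-∀
  ring : ∀ s a b c e → - + 1 * s * a + - + 1 * s * b - (s * c + - + 1 * (- + 1 * s) * e) ≡ - + 1 * s * (a + b + c + e)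
  ring = solve-∀

jacobiTerm-suc : ∀ n k f → k ≤ suc n → jacobiTerm (suc n) k f ≗ ∇ (suc n) (jacobiTerm-rhs n k f)
jacobiTerm-suc n k f k≤1+n m = begin
  sgn k * jacobiFactor (suc n) k f (m - + t)           ≡⟨ cong (sgn k *_) (jacobiFactor-suc n k f k≤1+n (m - + t)) ⟩
  sgn k * (R (m - + t) - R (m - + t - + suc n))        ≡⟨ distrib (sgn k) (R (m - + t)) _ ⟩
  sgn k * R (m - + t) - sgn k * R (m - + t - + suc n)
    ≡⟨ cong (λ u → sgn k * R (m - + t) - sgn k * u) (at-+≡+ R m (ℕP.+-comm t (suc n))) ⟩
  sgn k * R (m - + t) - sgn k * R (m - + suc n - + t)  ≡⟨ cong₂ _-_ (jacobiTerm-rhs-expand n k f m k≤1+n)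
                                                                    (jacobiTerm-rhs-expand n k f (m - + suc n) k≤1+n) ⟨
  ∇ (suc n) (jacobiTerm-rhs n k f) m                   ∎
  where
  open ≡-Reasoning
  t = triangular k
  R = jacobiFactor-rhs n k f
  distrib : ∀ s a b → s * (a - b) ≡ s * a - s * b
  distrib = solve-∀

jacobiSum : ℕ → Series → Series
jacobiSum n f m = Σ (suc n) (λ k → weight k * jacobiTerm n k f m)

jacobiSum-extend : ∀ n f m → Σ (suc (suc n)) (λ k → weight k * jacobiTerm n k f m) ≡ jacobiSum n f m
jacobiSum-extend n f m =
  trans (cong (λ x → jacobiSum n f m + weight (suc n) * x) (jacobiTerm-vanishes n (suc n) f m (ℕP.n<1+n n)))
        (trans (cong (λ x → jacobiSum n f m + x) (ℤP.*-zeroʳ (weight (suc n)))) (ℤP.+-identityʳ _))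

Σ-jacobiTerm-rhs : ∀ n f x →
  Σ (suc (suc n)) (λ k → weight k * jacobiTerm-rhs n k f x) ≡ ∇ (suc n) (∇ (suc n) (jacobiSum n f)) x
Σ-jacobiTerm-rhs n f x = begin
  Σ L (λ k → weight k * jacobiTerm-rhs n k f x)
    ≡⟨ Σ-cong L (λ k _ → distrib (weight k) (d k x) (d k x₂) (before c k) (c (suc k))) ⟩
  Σ L (λ k → weight k * d k x + weight k * d k x₂ - weight k * (before c k + c (suc k)))
    ≡⟨ Σ-- L _ _ ⟩
  Σ L (λ k → weight k * d k x + weight k * d k x₂) - Σ L (λ k → weight k * (before c k + c (suc k)))
    ≡⟨ cong₂ _-_ (Σ-+ L _ _) (Σ-weight-neighbours c (suc n)) ⟩
  Σ L (λ k → weight k * d k x) + Σ L (λ k → weight k * d k x₂)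
    - (+ 2 * Σ L (λ k → weight k * c k) - weight L * c (suc n) + weight (suc n) * c L)
    ≡⟨ cong₂ (λ u v → Σ L (λ k → weight k * d k x) + Σ L (λ k → weight k * d k x₂)
                        - (+ 2 * Σ L (λ k → weight k * c k) - weight L * u + weight (suc n) * v))
             (jacobiTerm-vanishes n (suc n) f x₁ (ℕP.n<1+n n))
             (jacobiTerm-vanishes n L f x₁ (ℕP.m<n⇒m<1+n (ℕP.n<1+n n))) ⟩
  Σ L (λ k → weight k * d k x) + Σ L (λ k → weight k * d k x₂)
    - (+ 2 * Σ L (λ k → weight k * c k) - weight L * + 0 + weight (suc n) * + 0)
    ≡⟨ cong₃ (λ u v w → u + v - (+ 2 * w - weight L * + 0 + weight (suc n) * + 0))
             (jacobiSum-extend n f x) (jacobiSum-extend n f x₂) (jacobiSum-extend n f x₁) ⟩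
  E x + E x₂ - (+ 2 * E x₁ - weight L * + 0 + weight (suc n) * + 0)
    ≡⟨ cong (λ u → E x + u - (+ 2 * E x₁ - weight L * + 0 + weight (suc n) * + 0)) (at-+ E x refl) ⟨
  E x + E (x₁ - + suc n) - (+ 2 * E x₁ - weight L * + 0 + weight (suc n) * + 0)
    ≡⟨ ring (E x) (E x₁) (E (x₁ - + suc n)) (weight L) (weight (suc n)) ⟩
  ∇ (suc n) (∇ (suc n) E) x  ∎
  where
  open ≡-Reasoning
  L = suc (suc n)
  x₁ = x - + suc n
  x₂ = x - + (suc n ℕ.+ suc n)
  d = λ k → jacobiTerm n k f
  c = λ k → jacobiTerm n k f x₁
  E = jacobiSum n f
  distrib : ∀ w p q r s → w * (p + q - (r + s)) ≡ w * p + w * q - w * (r + s)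
  distrib = solve-∀
  ring : ∀ p q r c₁ c₂ → p + r - (+ 2 * q - c₁ * + 0 + c₂ * + 0) ≡ p - q - (q - r)
  ring = solve-∀

jacobiSum-suc : ∀ n f → jacobiSum (suc n) f ≗ ∇ (suc n) (∇ (suc n) (∇ (suc n) (jacobiSum n f)))
jacobiSum-suc n f m = begin
  Σ L (λ k → weight k * jacobiTerm (suc n) k f m)
    ≡⟨ Σ-cong L (λ k k<L → trans (cong (weight k *_) (jacobiTerm-suc n k f (ℕP.≤-pred k<L) m)) (distrib (weight k) _ _)) ⟩
  Σ L (λ k → weight k * jacobiTerm-rhs n k f m - weight k * jacobiTerm-rhs n k f (m - + suc n))
    ≡⟨ Σ-- L _ _ ⟩
  Σ L (λ k → weight k * jacobiTerm-rhs n k f m) - Σ L (λ k → weight k * jacobiTerm-rhs n k f (m - + suc n))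
    ≡⟨ cong₂ _-_ (Σ-jacobiTerm-rhs n f m) (Σ-jacobiTerm-rhs n f (m - + suc n)) ⟩
  ∇ (suc n) (∇ (suc n) (∇ (suc n) (jacobiSum n f))) m  ∎
  where
  open ≡-Reasoning
  L = suc (suc n)
  distrib : ∀ w a b → w * (a - b) ≡ w * a - w * b
  distrib = solve-∀

pochhammer³-suc : ∀ n f → pochhammer (suc n) (pochhammer (suc n) (pochhammer (suc n) f)) ≗
                          ∇ (suc n) (∇ (suc n) (∇ (suc n) (pochhammer n (pochhammer n (pochhammer n f)))))
pochhammer³-suc n f = begin
  P′ (P′ (P′ f))            ≈⟨ pochhammer-suc n _ ⟩
  ∇ M (P (P′ (P′ f)))       ≈⟨ ∇-cong M (∇∏-cong (range 1 n) (pochhammer-suc n _)) ⟩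
  ∇ M (P (∇ M (P (P′ f))))  ≈⟨ ∇-cong M (pochhammer-∇ n M _) ⟩
  ∇ M (∇ M (P (P (P′ f))))  ≈⟨ ∇-cong M (∇-cong M (∇∏-cong (range 1 n) (∇∏-cong (range 1 n) (pochhammer-suc n f)))) ⟩
  ∇ M (∇ M (P (P (∇ M (P f)))))
    ≈⟨ ∇-cong M (∇-cong M (≗-trans (∇∏-cong (range 1 n) (pochhammer-∇ n M _)) (pochhammer-∇ n M _))) ⟩
  ∇ M (∇ M (∇ M (P (P (P f)))))  ∎
  where
  open ≗-Reasoning
  M = suc n
  P = pochhammer n
  P′ = pochhammer (suc n)

jacobi : ∀ n f → jacobiSum n f ≗ pochhammer n (pochhammer n (pochhammer n f))
jacobi zero    f m = trans (ring (f (m - + 0))) (at-0 f m)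
  where
  ring : ∀ x → + 0 + + 1 * (+ 1 * x) ≡ x
  ring = solve-∀
jacobi (suc n) f = begin
  jacobiSum (suc n) f                     ≈⟨ jacobiSum-suc n f ⟩
  ∇ M (∇ M (∇ M (jacobiSum n f)))         ≈⟨ ∇-cong M (∇-cong M (∇-cong M (jacobi n f))) ⟩
  ∇ M (∇ M (∇ M (P n (P n (P n f)))))     ≈⟨ pochhammer³-suc n f ⟨
  P (suc n) (P (suc n) (P (suc n) f))     ∎
  where
  open ≗-Reasoning
  M = suc n
  P = pochhammer

-- Pentagonal numbers

pos-3x²+x : ∀ x → + 3 * + x * + x + + x ≡ + (3 ℕ.* x ℕ.* x ℕ.+ x)
pos-3x²+x x = sym (trans (ℤP.pos-+ (3 ℕ.* x ℕ.* x) x)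
                         (cong (_+ + x) (trans (ℤP.pos-* (3 ℕ.* x) x) (cong (_* + x) (ℤP.pos-* 3 x)))))

-- w_j without the division by 2
pentagonal : ℤ → ℕ
pentagonal (+ i)    = i ℕ.* i ℕ.+ triangular i
pentagonal -[1+ i ] = suc i ℕ.* suc i ℕ.+ triangular i

pentagonal-double : ∀ j → + 3 * j * j + j ≡ + (pentagonal j ℕ.* 2)
pentagonal-double (+ i) = trans (pos-3x²+x i) (cong +_ (begin
  3 ℕ.* i ℕ.* i ℕ.+ i                           ≡⟨ ℕ-solve (i ∷ []) ⟩
  i ℕ.* i ℕ.* 2 ℕ.+ (i ℕ.* i ℕ.+ i)             ≡⟨ cong (i ℕ.* i ℕ.* 2 ℕ.+_) (triangular-double i) ⟨
  i ℕ.* i ℕ.* 2 ℕ.+ triangular i ℕ.* 2          ≡⟨ ℕP.*-distribʳ-+ 2 (i ℕ.* i) (triangular i) ⟨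
  (i ℕ.* i ℕ.+ triangular i) ℕ.* 2              ∎))
  where open ≡-Reasoning
pentagonal-double -[1+ i ] = begin
  + 3 * - y * - y + - y                ≡⟨ ring y ⟩
  + 3 * y * y + y - y - y              ≡⟨ cong (λ z → z - y - y) (trans (pos-3x²+x (suc i)) (cong +_ 3y²+y)) ⟩
  + (w ℕ.+ suc i ℕ.+ suc i) - y - y    ≡⟨ cong (λ z → z - y - y) (trans (ℤP.pos-+ (w ℕ.+ suc i) (suc i))
                                                                         (cong (_+ y) (ℤP.pos-+ w (suc i)))) ⟩
  + w + y + y - y - y                  ≡⟨ cancel (+ w) y ⟩
  + w                                  ∎
  where
  open ≡-Reasoning
  y = + suc i
  w = pentagonal -[1+ i ] ℕ.* 2
  ring : ∀ y → + 3 * - y * - y + - y ≡ + 3 * y * y + y - y - y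
  ring = solve-∀
  cancel : ∀ a b → a + b + b - b - b ≡ a
  cancel = solve-∀
  3y²+y : 3 ℕ.* suc i ℕ.* suc i ℕ.+ suc i ≡ w ℕ.+ suc i ℕ.+ suc i
  3y²+y = begin
    3 ℕ.* suc i ℕ.* suc i ℕ.+ suc i                              ≡⟨ ℕ-solve (i ∷ []) ⟩
    suc i ℕ.* suc i ℕ.* 2 ℕ.+ (i ℕ.* i ℕ.+ i) ℕ.+ suc i ℕ.+ suc i
      ≡⟨ cong (λ t → suc i ℕ.* suc i ℕ.* 2 ℕ.+ t ℕ.+ suc i ℕ.+ suc i) (triangular-double i) ⟨
    suc i ℕ.* suc i ℕ.* 2 ℕ.+ triangular i ℕ.* 2 ℕ.+ suc i ℕ.+ suc i
      ≡⟨ cong (λ t → t ℕ.+ suc i ℕ.+ suc i) (ℕP.*-distribʳ-+ 2 (suc i ℕ.* suc i) (triangular i)) ⟨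
    w ℕ.+ suc i ℕ.+ suc i                                        ∎

pent≡pentagonal : ∀ j → pent j ≡ pentagonal j
pent≡pentagonal j = trans (cong (λ z → ∣ z ∣ / 2) (pentagonal-double j)) (m*n/n≡m (pentagonal j) 2)

pent-double : ∀ j → + 3 * j * j + j ≡ + (pent j ℕ.* 2)
pent-double j = trans (pentagonal-double j) (cong (λ p → + (p ℕ.* 2)) (sym (pent≡pentagonal j)))

3k+1≢0 : ∀ k → + 3 * k + + 1 ≢ + 0
3k+1≢0 k 3k+1≡0 = 3≢1 (ℕP.m*n≡1⇒m≡1 3 ∣ - k ∣ (sym (trans (cong ∣_∣ 1≡3[-k]) (ℤP.abs-* (+ 3) (- k)))))
  where
  3≢1 : 3 ≢ 1
  3≢1 ()
  ring : ∀ k → + 1 ≡ + 3 * k + + 1 + + 3 * - k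
  ring = solve-∀
  1≡3[-k] : + 1 ≡ + 3 * - k
  1≡3[-k] = trans (ring k) (trans (cong (λ z → z + + 3 * - k) 3k+1≡0) (ℤP.+-identityˡ (+ 3 * - k)))

pent-injective : ∀ i j → pent i ≡ pent j → i ≡ j
pent-injective i j w≡w = ℤP.i-j≡0⇒i≡j i j ([ id , ⊥-elim ∘ 3k+1≢0 (i + j) ]′ (ℤP.i*j≡0⇒i≡0∨j≡0 (i - j) factored))
  where
  open ≡-Reasoning
  factored : (i - j) * (+ 3 * (i + j) + + 1) ≡ + 0
  factored = begin
    (i - j) * (+ 3 * (i + j) + + 1)            ≡⟨ ring i j ⟩
    (+ 3 * i * i + i) - (+ 3 * j * j + j)      ≡⟨ cong₂ _-_ (pent-double i) (pent-double j) ⟩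
    + (pent i ℕ.* 2) - + (pent j ℕ.* 2)        ≡⟨ cong (λ p → + (p ℕ.* 2) - + (pent j ℕ.* 2)) w≡w ⟩
    + (pent j ℕ.* 2) - + (pent j ℕ.* 2)        ≡⟨ ℤP.+-inverseʳ (+ (pent j ℕ.* 2)) ⟩
    + 0                                        ∎
    where
    ring : ∀ i j → (i - j) * (+ 3 * (i + j) + + 1) ≡ (+ 3 * i * i + i) - (+ 3 * j * j + j)
    ring = solve-∀

∣j∣≤pent : ∀ j → ∣ j ∣ ≤ pent j
∣j∣≤pent j = subst (∣ j ∣ ≤_) (sym (pent≡pentagonal j)) (bound j)
  where
  bound : ∀ j → ∣ j ∣ ≤ pentagonal j
  bound (+ i)    = ℕP.≤-trans (triangular-≥ i) (ℕP.m≤n+m (triangular i) (i ℕ.* i))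
  bound -[1+ i ] = ℕP.≤-trans (ℕP.m≤m*n (suc i) (suc i)) (ℕP.m≤m+n (suc i ℕ.* suc i) (triangular i))

-- Shanks' finite form of the pentagonal number theorem

pentagonalSum : ℕ → Series → Series
pentagonalSum zero    f m = f m
pentagonalSum (suc n) f m = pentagonalSum n f m + sgn (suc n) * (f (m - + pent -[1+ n ]) + f (m - + pent (+ suc n)))

shanksTerm : ℕ → ℕ → Series → Series
shanksTerm n k f m = sgn k * ∇∏ (range (suc k) (n ∸ k)) f (m - + (n ℕ.* k ℕ.+ triangular k))

shanksSum : ℕ → Series → Series
shanksSum n f m = Σ (suc n) (λ k → shanksTerm n k f m)

shanksBoundary : ℕ → ℕ → Series → Series
shanksBoundary n k f m = sgn k * ∇∏ (range k (suc n ∸ k)) f (m - + (triangular k ℕ.+ n ℕ.* k))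

shanksTerm-suc : ∀ n k f m → k ≤ n →
  shanksTerm (suc n) k f m ≡ shanksTerm n k f m - shanksBoundary n k f m + shanksBoundary n (suc k) f m
shanksTerm-suc n k f m k≤n = begin
  sgn k * ∇∏ (range (suc k) (suc n ∸ k)) f (m - + c₁)
    ≡⟨ cong (λ l → sgn k * ∇∏ (range (suc k) l) f (m - + c₁)) 1+n∸k ⟩
  sgn k * ∇∏ (range (suc k) (suc (n ∸ k))) f (m - + c₁)
    ≡⟨ cong (sgn k *_) (∇∏-range-suc (suc k) (n ∸ k) f (m - + c₁)) ⟩
  sgn k * ∇ (suc k ℕ.+ (n ∸ k)) g (m - + c₁)
    ≡⟨ cong (λ a → sgn k * ∇ a g (m - + c₁)) (cong suc (ℕP.m+[n∸m]≡n k≤n)) ⟩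
  sgn k * (g (m - + c₁) - g (m - + c₁ - + suc n))
    ≡⟨ cong₂ (λ u v → sgn k * (u - v)) (sym (at-+ g m (c₂+k n k (triangular k)))) (at-+ g m (c₁+n+1 n k (triangular k))) ⟩
  sgn k * (g (m - + c₂ - + k) - g (m - + c₃))
    ≡⟨ ring (sgn k) (g (m - + c₂)) (g (m - + c₂ - + k)) (g (m - + c₃)) ⟩
  sgn k * g (m - + c₂) - sgn k * ∇ k g (m - + c₂) + sgn (suc k) * g (m - + c₃)
    ≡⟨ cong₂ (λ u v → sgn k * u - sgn k * v + sgn (suc k) * g (m - + c₃))
             (cong (λ c → g (m - + c)) (ℕP.+-comm (n ℕ.* k) (triangular k)))
             (cong (λ l → ∇∏ (range k l) f (m - + c₂)) 1+n∸k) ⟨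
  shanksTerm n k f m - shanksBoundary n k f m + shanksBoundary n (suc k) f m  ∎
  where
  open ≡-Reasoning
  g = ∇∏ (range (suc k) (n ∸ k)) f
  c₁ = suc n ℕ.* k ℕ.+ triangular k
  c₂ = triangular k ℕ.+ n ℕ.* k
  c₃ = triangular (suc k) ℕ.+ n ℕ.* suc k
  1+n∸k : suc n ∸ k ≡ suc (n ∸ k)
  1+n∸k = ℕP.+-∸-assoc 1 k≤n
  c₂+k : ∀ n k t → t ℕ.+ n ℕ.* k ℕ.+ k ≡ suc n ℕ.* k ℕ.+ t
  c₂+k = ℕ-solve-∀
  c₁+n+1 : ∀ n k t → suc n ℕ.* k ℕ.+ t ℕ.+ suc n ≡ t ℕ.+ suc k ℕ.+ n ℕ.* suc k
  c₁+n+1 = ℕ-solve-∀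
  ring : ∀ s x y z → s * (y - z) ≡ s * x - s * (x - y) + - + 1 * s * z
  ring = solve-∀

shanks : ∀ n f → shanksSum n f ≗ pentagonalSum n f
shanks zero    f m = trans (ring (f (m - + 0))) (at-0 f m)
  where
  ring : ∀ x → + 0 + + 1 * x ≡ x
  ring = solve-∀
shanks (suc n) f m = begin
  Σ (suc n) (λ k → shanksTerm (suc n) k f m) + shanksTerm (suc n) (suc n) f m
    ≡⟨ cong₂ _+_ (Σ-cong (suc n) (λ k k<1+n → shanksTerm-suc n k f m (ℕP.≤-pred k<1+n))) top ⟩
  Σ (suc n) (λ k → shanksTerm n k f m - B k + B (suc k)) + sgn (suc n) * f (m - + pent (+ suc n))
    ≡⟨ cong (_+ sgn (suc n) * f (m - + pent (+ suc n))) (Σ-telescope (suc n) (λ k → shanksTerm n k f m) B) ⟩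
  shanksSum n f m - B 0 + B (suc n) + sgn (suc n) * f (m - + pent (+ suc n))
    ≡⟨ cong₃ (λ x y z → x - y + z + sgn (suc n) * f (m - + pent (+ suc n))) (shanks n f m) B-first B-last ⟩
  pentagonalSum n f m - + 0 + sgn (suc n) * f (m - + pent -[1+ n ]) + sgn (suc n) * f (m - + pent (+ suc n))
    ≡⟨ ring (pentagonalSum n f m) (sgn (suc n)) (f (m - + pent -[1+ n ])) (f (m - + pent (+ suc n))) ⟩
  pentagonalSum (suc n) f m  ∎
  where
  open ≡-Reasoning
  B = λ k → shanksBoundary n k f m
  B-first : B 0 ≡ + 0
  B-first = cong (+ 1 *_) (∇-zero (∇∏ (range 1 n) f) (m - + (0 ℕ.+ n ℕ.* 0)))
  at-w : ∀ {c} j → c ≡ pentagonal j → f (m - + c) ≡ f (m - + pent j)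
  at-w j eq = cong (λ c → f (m - + c)) (trans eq (sym (pent≡pentagonal j)))
  B-last : B (suc n) ≡ sgn (suc n) * f (m - + pent -[1+ n ])
  B-last = cong (sgn (suc n) *_)
    (trans (cong (λ l → ∇∏ (range (suc n) l) f (m - + (triangular (suc n) ℕ.+ n ℕ.* suc n))) (ℕP.n∸n≡0 n))
           (at-w -[1+ n ] (rearrange n (triangular n))))
    where
    rearrange : ∀ n t → t ℕ.+ suc n ℕ.+ n ℕ.* suc n ≡ suc n ℕ.* suc n ℕ.+ t
    rearrange = ℕ-solve-∀
  top : shanksTerm (suc n) (suc n) f m ≡ sgn (suc n) * f (m - + pent (+ suc n))
  top = cong (sgn (suc n) *_)
    (trans (cong (λ l → ∇∏ (range (suc (suc n)) l) f (m - + (suc n ℕ.* suc n ℕ.+ triangular (suc n)))) (ℕP.n∸n≡0 n))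
           (at-w (+ suc n) refl))
  ring : ∀ E s x y → E - + 0 + s * x + s * y ≡ E + s * (x + y)
  ring = solve-∀

δ : Series
δ (+ zero)  = + 1
δ (+ suc _) = + 0
δ -[1+ _ ]  = + 0

δ-≢ : ∀ a b → a ≢ b → δ (+ a - + b) ≡ + 0
δ-≢ a b a≢b with + a - + b in eq
... | + zero  = ⊥-elim (a≢b (ℤP.+-injective (ℤP.i-j≡0⇒i≡j (+ a) (+ b) eq)))
... | + suc _ = refl
... | -[1+ _ ] = refl

δ-self : ∀ a → δ (+ a - + a) ≡ + 1
δ-self a = cong δ (ℤP.+-inverseʳ (+ a))

pentagonalSum-δ-off : ∀ n N → (∀ j → ∣ j ∣ ≤ n → N ≢ pent j) → pentagonalSum n δ (+ N) ≡ + 0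
pentagonalSum-δ-off zero    N N≢w = trans (cong δ (sym (ℤP.+-identityʳ (+ N)))) (δ-≢ N 0 (N≢w (+ 0) z≤n))
pentagonalSum-δ-off (suc n) N N≢w = begin
  pentagonalSum n δ (+ N) + sgn (suc n) * (δ (+ N - + pent -[1+ n ]) + δ (+ N - + pent (+ suc n)))
    ≡⟨ cong₃ (λ u v w → u + sgn (suc n) * (v + w))
             (pentagonalSum-δ-off n N (λ j ∣j∣≤n → N≢w j (ℕP.m≤n⇒m≤1+n ∣j∣≤n)))
             (δ-≢ N _ (N≢w -[1+ n ] ℕP.≤-refl)) (δ-≢ N _ (N≢w (+ suc n) ℕP.≤-refl)) ⟩
  + 0 + sgn (suc n) * (+ 0 + + 0)
    ≡⟨ trans (ℤP.+-identityˡ _) (ℤP.*-zeroʳ (sgn (suc n))) ⟩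
  + 0  ∎
  where open ≡-Reasoning

pentagonalSum-δ-top : ∀ n j → ∣ j ∣ ≡ suc n → pentagonalSum (suc n) δ (+ pent j) ≡ sgn (suc n)
pentagonalSum-δ-top n j ∣j∣≡1+n = begin
  pentagonalSum n δ (+ pent j) + sgn (suc n) * (δ (+ pent j - + pent -[1+ n ]) + δ (+ pent j - + pent (+ suc n)))
    ≡⟨ cong (_+ sgn (suc n) * (δ (+ pent j - + pent -[1+ n ]) + δ (+ pent j - + pent (+ suc n))))
            (pentagonalSum-δ-off n (pent j) lower) ⟩
  + 0 + sgn (suc n) * (δ (+ pent j - + pent -[1+ n ]) + δ (+ pent j - + pent (+ suc n)))
    ≡⟨ cong (λ z → + 0 + sgn (suc n) * z) (exactly-one j ∣j∣≡1+n) ⟩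
  + 0 + sgn (suc n) * + 1
    ≡⟨ trans (ℤP.+-identityˡ _) (ℤP.*-identityʳ (sgn (suc n))) ⟩
  sgn (suc n)  ∎
  where
  open ≡-Reasoning
  lower : ∀ i → ∣ i ∣ ≤ n → pent j ≢ pent i
  lower i ∣i∣≤n w≡w = ℕP.<⇒≢ (s≤s ∣i∣≤n) (trans (cong ∣_∣ (sym (pent-injective j i w≡w))) ∣j∣≡1+n)
  exactly-one : ∀ j → ∣ j ∣ ≡ suc n → δ (+ pent j - + pent -[1+ n ]) + δ (+ pent j - + pent (+ suc n)) ≡ + 1
  exactly-one (+ suc .n)  refl = cong₂ _+_ (δ-≢ _ _ (λ w≡w → case (pent-injective _ _ w≡w))) (δ-self (pent (+ suc n)))
    where
    case : + suc n ≢ -[1+ n ]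
    case ()
  exactly-one -[1+ .n ]   refl = trans (cong₂ _+_ (δ-self (pent -[1+ n ])) (δ-≢ _ _ (λ w≡w → case (pent-injective _ _ w≡w))))
                                       (ℤP.+-identityʳ (+ 1))
    where
    case : -[1+ n ] ≢ + suc n
    case ()

pentagonalSum-δ-on : ∀ n j → ∣ j ∣ ≤ n → pentagonalSum n δ (+ pent j) ≡ sgn ∣ j ∣
pentagonalSum-δ-on zero    (+ zero) z≤n = refl
pentagonalSum-δ-on (suc n) j ∣j∣≤1+n with ℕP.m≤n⇒m<n∨m≡n ∣j∣≤1+n
... | inj₁ ∣j∣≤n = begin
  pentagonalSum n δ (+ pent j) + sgn (suc n) * (δ (+ pent j - + pent -[1+ n ]) + δ (+ pent j - + pent (+ suc n)))
    ≡⟨ cong₃ (λ u v w → u + sgn (suc n) * (v + w)) (pentagonalSum-δ-on n j (ℕP.≤-pred ∣j∣≤n))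
             (δ-≢ _ _ (other -[1+ n ] refl)) (δ-≢ _ _ (other (+ suc n) refl)) ⟩
  sgn (∣ j ∣) + sgn (suc n) * (+ 0 + + 0)
    ≡⟨ trans (cong (λ z → sgn (∣ j ∣) + z) (ℤP.*-zeroʳ (sgn (suc n)))) (ℤP.+-identityʳ (sgn (∣ j ∣))) ⟩
  sgn (∣ j ∣)  ∎
  where
  open ≡-Reasoning
  other : ∀ i → ∣ i ∣ ≡ suc n → pent j ≢ pent i
  other i ∣i∣≡1+n w≡w = ℕP.<⇒≢ ∣j∣≤n (trans (cong ∣_∣ (pent-injective j i w≡w)) ∣i∣≡1+n)
... | inj₂ ∣j∣≡1+n = trans (pentagonalSum-δ-top n j ∣j∣≡1+n) (cong sgn (sym ∣j∣≡1+n))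

-- Two-coloured partitions

sumUpTo : ℕ → (ℕ → ℕ) → ℕ
sumUpTo n h = sum (map h (upTo n))

sumUpTo-cong : ∀ n {h h′} → h ≗ h′ → sumUpTo n h ≡ sumUpTo n h′
sumUpTo-cong n h≗h′ = cong sum (ListP.map-cong h≗h′ (upTo n))

sumUpTo-suc : ∀ n h → sumUpTo (suc n) h ≡ h 0 ℕ.+ sumUpTo n (h ∘ suc)
sumUpTo-suc n h = cong (λ hs → h 0 ℕ.+ sum hs)
  (trans (ListP.map-applyUpTo suc h n) (sym (ListP.map-applyUpTo id (h ∘ suc) n)))

sumUpTo-∷ʳ : ∀ n h → sumUpTo (suc n) h ≡ sumUpTo n h ℕ.+ h n
sumUpTo-∷ʳ n h = begin
  sum (map h (upTo (suc n)))               ≡⟨ cong (sum ∘ map h) (ListP.upTo-∷ʳ n) ⟨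
  sum (map h (upTo n ∷ʳ n))                 ≡⟨ cong sum (ListP.map-++ h (upTo n) (n ∷ [])) ⟩
  sum (map h (upTo n) ++ h n ∷ [])         ≡⟨ SumP.sum-++ (map h (upTo n)) (h n ∷ []) ⟩
  sumUpTo n h ℕ.+ (h n ℕ.+ 0)              ≡⟨ cong (sumUpTo n h ℕ.+_) (ℕP.+-identityʳ (h n)) ⟩
  sumUpTo n h ℕ.+ h n                      ∎
  where open ≡-Reasoning

sumUpTo-zero : ∀ n h → (∀ r → h r ≡ 0) → sumUpTo n h ≡ 0
sumUpTo-zero zero    h h≡0 = refl
sumUpTo-zero (suc n) h h≡0 = trans (sumUpTo-∷ʳ n h) (cong₂ ℕ._+_ (sumUpTo-zero n h h≡0) (h≡0 n))

sumUpTo-+ : ∀ n k h → (∀ r → n ≤ r → h r ≡ 0) → sumUpTo (n ℕ.+ k) h ≡ sumUpTo n h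
sumUpTo-+ n zero    h h≡0 = cong (λ m → sumUpTo m h) (ℕP.+-identityʳ n)
sumUpTo-+ n (suc k) h h≡0 = begin
  sumUpTo (n ℕ.+ suc k) h             ≡⟨ cong (λ m → sumUpTo m h) (ℕP.+-suc n k) ⟩
  sumUpTo (suc (n ℕ.+ k)) h           ≡⟨ sumUpTo-∷ʳ (n ℕ.+ k) h ⟩
  sumUpTo (n ℕ.+ k) h ℕ.+ h (n ℕ.+ k) ≡⟨ cong₂ ℕ._+_ (sumUpTo-+ n k h h≡0) (h≡0 (n ℕ.+ k) (ℕP.m≤m+n n k)) ⟩
  sumUpTo n h ℕ.+ 0                   ≡⟨ ℕP.+-identityʳ _ ⟩
  sumUpTo n h                         ∎
  where open ≡-Reasoning

waysTerm : ℕ → List ℕ → ℕ → ℕ → ℕ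
waysTerm x xs n r with r ℕ.* x ≤? n
... | yes _ = ways xs (n ∸ r ℕ.* x)
... | no  _ = 0

ways-∷ : ∀ x xs n → ways (x ∷ xs) n ≡ sumUpTo (suc n) (waysTerm x xs n)
ways-∷ x xs n = trans (proj₂ summand) (sumUpTo-cong (suc n) agree)
  where
  -- the summand of ways is local to its definition; unification names it
  summand : Σ[ F ∈ (ℕ → ℕ) ] ways (x ∷ xs) n ≡ sum (map F (upTo (suc n)))
  summand = _ , refl
  agree : proj₁ summand ≗ waysTerm x xs n
  agree r with r ℕ.* x ≤? n
  ... | yes _ = refl
  ... | no  _ = refl

waysTerm-≤ : ∀ x xs n r → r ℕ.* x ≤ n → waysTerm x xs n r ≡ ways xs (n ∸ r ℕ.* x)
waysTerm-≤ x xs n r r*x≤n with r ℕ.* x ≤? n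
... | yes _    = refl
... | no  r*x≰n = ⊥-elim (r*x≰n r*x≤n)

waysTerm-≰ : ∀ x xs n r → ¬ r ℕ.* x ≤ n → waysTerm x xs n r ≡ 0
waysTerm-≰ x xs n r r*x≰n with r ℕ.* x ≤? n
... | yes r*x≤n = ⊥-elim (r*x≰n r*x≤n)
... | no  _     = refl

ways-small : ∀ x xs n → n < x → ways (x ∷ xs) n ≡ ways xs n
ways-small x xs n n<x = begin
  ways (x ∷ xs) n                                              ≡⟨ trans (ways-∷ x xs n) (sumUpTo-suc n _) ⟩
  waysTerm x xs n 0 ℕ.+ sumUpTo n (waysTerm x xs n ∘ suc)
    ≡⟨ cong₂ ℕ._+_ (waysTerm-≤ x xs n 0 z≤n) (sumUpTo-zero n _ too-big) ⟩
  ways xs n ℕ.+ 0                                              ≡⟨ ℕP.+-identityʳ _ ⟩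
  ways xs n                                                    ∎
  where
  open ≡-Reasoning
  too-big : ∀ r → waysTerm x xs n (suc r) ≡ 0
  too-big r = waysTerm-≰ x xs n (suc r) (λ le → ℕP.<⇒≱ n<x (ℕP.≤-trans (ℕP.m≤m+n x (r ℕ.* x)) le))

waysTerm-suc : ∀ x xs q r → x ≤ q → waysTerm x xs q (suc r) ≡ waysTerm x xs (q ∸ x) r
waysTerm-suc x xs q r x≤q = by-cases (r ℕ.* x ≤? q ∸ x)
  where
  by-cases : Dec (r ℕ.* x ≤ q ∸ x) → waysTerm x xs q (suc r) ≡ waysTerm x xs (q ∸ x) r
  by-cases (yes r*x≤q-x) = trans (waysTerm-≤ x xs q (suc r) x+r*x≤q)
    (trans (cong (ways xs) (sym (ℕP.∸-+-assoc q x (r ℕ.* x)))) (sym (waysTerm-≤ x xs (q ∸ x) r r*x≤q-x)))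
    where
    x+r*x≤q : x ℕ.+ r ℕ.* x ≤ q
    x+r*x≤q = subst (x ℕ.+ r ℕ.* x ≤_) (ℕP.m+[n∸m]≡n x≤q) (ℕP.+-monoʳ-≤ x r*x≤q-x)
  by-cases (no r*x≰q-x) = trans (waysTerm-≰ x xs q (suc r) x+r*x≰q) (sym (waysTerm-≰ x xs (q ∸ x) r r*x≰q-x))
    where
    x+r*x≰q : ¬ x ℕ.+ r ℕ.* x ≤ q
    x+r*x≰q le = r*x≰q-x (subst (_≤ q ∸ x) (ℕP.m+n∸m≡n x (r ℕ.* x)) (ℕP.∸-monoˡ-≤ x le))

ways-step : ∀ x xs q → suc x ≤ q → ways (suc x ∷ xs) q ≡ ways xs q ℕ.+ ways (suc x ∷ xs) (q ∸ suc x)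
ways-step x xs q x<q = begin
  ways (suc x ∷ xs) q
    ≡⟨ trans (ways-∷ (suc x) xs q) (sumUpTo-suc q _) ⟩
  waysTerm (suc x) xs q 0 ℕ.+ sumUpTo q (waysTerm (suc x) xs q ∘ suc)
    ≡⟨ cong₂ ℕ._+_ (waysTerm-≤ (suc x) xs q 0 z≤n) (sumUpTo-cong q (λ r → waysTerm-suc (suc x) xs q r x<q)) ⟩
  ways xs q ℕ.+ sumUpTo q (waysTerm (suc x) xs q′)
    ≡⟨ cong (λ m → ways xs q ℕ.+ sumUpTo m (waysTerm (suc x) xs q′)) q≡1+q′+x ⟩
  ways xs q ℕ.+ sumUpTo (suc q′ ℕ.+ x) (waysTerm (suc x) xs q′)
    ≡⟨ cong (ways xs q ℕ.+_) (sumUpTo-+ (suc q′) x _ beyond) ⟩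
  ways xs q ℕ.+ sumUpTo (suc q′) (waysTerm (suc x) xs q′)
    ≡⟨ cong (ways xs q ℕ.+_) (ways-∷ (suc x) xs q′) ⟨
  ways xs q ℕ.+ ways (suc x ∷ xs) q′  ∎
  where
  open ≡-Reasoning
  q′ = q ∸ suc x
  q≡1+q′+x : q ≡ suc q′ ℕ.+ x
  q≡1+q′+x = sym (trans (sym (ℕP.+-suc q′ x)) (ℕP.m∸n+n≡m x<q))
  beyond : ∀ r → suc q′ ≤ r → waysTerm (suc x) xs q′ r ≡ 0
  beyond r q′<r = waysTerm-≰ (suc x) xs q′ r (λ le → ℕP.<⇒≱ q′<r (ℕP.≤-trans (ℕP.m≤m*n r (suc x)) le))

ways-++ : ∀ xs ys n → All (n <_) ys → ways (xs ++ ys) n ≡ ways xs n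
ways-++ []       []       n All.[]              = refl
ways-++ []       (y ∷ ys) n (n<y All.∷ n<ys) = trans (ways-small y ys n n<y) (ways-++ [] ys n n<ys)
ways-++ (x ∷ xs) ys       n n<ys               =
  trans (ways-∷ x (xs ++ ys) n) (trans (sumUpTo-cong (suc n) agree) (sym (ways-∷ x xs n)))
  where
  agree : waysTerm x (xs ++ ys) n ≗ waysTerm x xs n
  agree r with r ℕ.* x ≤? n
  ... | yes _ = ways-++ xs ys (n ∸ r ℕ.* x) (All.map (ℕP.≤-<-trans (ℕP.m∸n≤m n (r ℕ.* x))) n<ys)
  ... | no  _ = refl

waysSeries : List ℕ → Series
waysSeries xs (+ n)    = + ways xs n
waysSeries xs -[1+ _ ] = + 0

∇-waysSeries : ∀ x xs → ∇ (suc x) (waysSeries (suc x ∷ xs)) ≗ waysSeries xs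
∇-waysSeries x xs -[1+ k ] = refl
∇-waysSeries x xs (+ q) with suc x ≤? q
... | yes x<q = begin
  + ways (suc x ∷ xs) q - waysSeries (suc x ∷ xs) (+ q - + suc x)
    ≡⟨ cong (λ z → + ways (suc x ∷ xs) q - waysSeries (suc x ∷ xs) z) (trans (ℤP.m-n≡m⊖n q (suc x)) (ℤP.⊖-≥ x<q)) ⟩
  + ways (suc x ∷ xs) q - + ways (suc x ∷ xs) (q ∸ suc x)
    ≡⟨ cong (λ w → + w - + ways (suc x ∷ xs) (q ∸ suc x)) (ways-step x xs q x<q) ⟩
  + (ways xs q ℕ.+ ways (suc x ∷ xs) (q ∸ suc x)) - + ways (suc x ∷ xs) (q ∸ suc x)
    ≡⟨ cong (_- + ways (suc x ∷ xs) (q ∸ suc x)) (ℤP.pos-+ (ways xs q) (ways (suc x ∷ xs) (q ∸ suc x))) ⟩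
  + ways xs q + + ways (suc x ∷ xs) (q ∸ suc x) - + ways (suc x ∷ xs) (q ∸ suc x)
    ≡⟨ cancel (+ ways xs q) (+ ways (suc x ∷ xs) (q ∸ suc x)) ⟩
  + ways xs q  ∎
  where
  open ≡-Reasoning
  cancel : ∀ a b → a + b - b ≡ a
  cancel = solve-∀
... | no x≮q = trans (cong (λ z → + ways (suc x ∷ xs) q - z) (PowerSeries-below {waysSeries (suc x ∷ xs)} (λ _ → refl) (ℕP.≰⇒> x≮q)))
                     (trans (ℤP.+-identityʳ _) (cong +_ (ways-small (suc x) xs q (ℕP.≰⇒> x≮q))))

∇∏-waysSeries : ∀ xs → All (0 <_) xs → ∇∏ xs (waysSeries xs) ≗ δ
∇∏-waysSeries []           All.[]         (+ zero)  = refl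
∇∏-waysSeries []           All.[]         (+ suc _) = refl
∇∏-waysSeries []           All.[]         -[1+ _ ]  = refl
∇∏-waysSeries (suc x ∷ xs) (_ All.∷ xs⁺) =
  ≗-trans (≗-sym (∇∏-∇ xs (suc x) (waysSeries (suc x ∷ xs))))
          (≗-trans (∇∏-cong xs (∇-waysSeries x xs)) (∇∏-waysSeries xs xs⁺))

colouredParts-suc : ∀ n → colouredParts 2 (suc n) ≡ colouredParts 2 n ++ suc n ∷ suc n ∷ []
colouredParts-suc n = trans (cong (concatMap copies) (sym (ListP.upTo-∷ʳ n))) (ListP.concatMap-++ copies (upTo n) (n ∷ []))
  where
  copies : ℕ → List ℕ
  copies m = map (λ _ → suc m) (upTo 2)

colouredParts-+ : ∀ q k → ∃ λ ys → colouredParts 2 (q ℕ.+ k) ≡ colouredParts 2 q ++ ys × All (q <_) ys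
colouredParts-+ q zero = [] , trans (cong (colouredParts 2) (ℕP.+-identityʳ q)) (sym (ListP.++-identityʳ _)) , All.[]
colouredParts-+ q (suc k) with colouredParts-+ q k
... | ys , eq , q<ys =
  ys ++ m ∷ m ∷ [] ,
  trans (cong (colouredParts 2) (ℕP.+-suc q k))
        (trans (colouredParts-suc (q ℕ.+ k)) (trans (cong (_++ m ∷ m ∷ []) eq) (ListP.++-assoc (colouredParts 2 q) ys _))) ,
  AllP.++⁺ q<ys (q<m All.∷ q<m All.∷ All.[])
  where
  m = suc (q ℕ.+ k)
  q<m : q < m
  q<m = s≤s (ℕP.m≤m+n q k)

colouredParts-positive : ∀ n → All (0 <_) (colouredParts 2 n)
colouredParts-positive n with colouredParts-+ 0 n
... | ys , eq , 0<ys = subst (All (0 <_)) (sym eq) 0<ys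

waysSeries-p₂ : ∀ N q → q ≤ N → waysSeries (colouredParts 2 N) (+ q) ≡ p₂ (+ q)
waysSeries-p₂ N q q≤N with colouredParts-+ q (N ∸ q)
... | ys , eq , q<ys = cong +_ (trans (cong (λ M → ways (colouredParts 2 M) q) (sym (ℕP.m+[n∸m]≡n q≤N)))
                                      (trans (cong (λ ps → ways ps q) eq) (ways-++ (colouredParts 2 q) ys q q<ys)))

pochhammer²-colouredParts : ∀ n g → pochhammer n (pochhammer n g) ≗ ∇∏ (colouredParts 2 n) g
pochhammer²-colouredParts zero    g m = refl
pochhammer²-colouredParts (suc n) g = begin
  pochhammer (suc n) (pochhammer (suc n) g)  ≈⟨ pochhammer-suc n _ ⟩
  ∇ M (pochhammer n (pochhammer (suc n) g))  ≈⟨ ∇-cong M (∇∏-cong (range 1 n) (pochhammer-suc n g)) ⟩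
  ∇ M (pochhammer n (∇ M (pochhammer n g)))  ≈⟨ ∇-cong M (pochhammer-∇ n M _) ⟩
  ∇ M (∇ M (pochhammer n (pochhammer n g)))  ≈⟨ ∇-cong M (∇-cong M (pochhammer²-colouredParts n g)) ⟩
  ∇ M (∇ M (∇∏ (colouredParts 2 n) g))       ≈⟨ ∇∏-∇² (colouredParts 2 n) M M g ⟨
  ∇∏ (colouredParts 2 n) (∇ M (∇ M g))       ≈⟨ ∇∏-++ (colouredParts 2 n) (M ∷ M ∷ []) g ⟨
  ∇∏ (colouredParts 2 n ++ M ∷ M ∷ []) g     ≈⟨ cong-≗ (λ ps → ∇∏ ps g) (colouredParts-suc n) ⟨
  ∇∏ (colouredParts 2 (suc n)) g             ∎
  where
  open ≗-Reasoning
  M = suc n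

-- The recurrence for 𝔭₂

rhsTerm : ℕ → ℕ → ℤ
rhsTerm N k = weight k * (sgn k * p₂ (+ N - + tri k))

rhsSum-unfold : ∀ N → rhsSum N ≡ Σ N (λ i → sgn (suc (suc i)) * weight (suc i) * p₂ (+ N - + tri (suc i)))
rhsSum-unfold N = trans (proj₁ facts) (Σ-applyUpTo {S} _ (proj₁ (proj₂ facts)) (proj₂ (proj₂ facts)) N id)
  where
  -- the list sum local to rhsSum, named by unification once `with` has abstracted upTo N
  S : List ℕ → ℤ
  S = _
  facts : rhsSum N ≡ S (upTo N) × S [] ≡ + 0
          × (∀ i is → S (i ∷ is) ≡ sgn (suc (suc i)) * weight (suc i) * p₂ (+ N - + tri (suc i)) + S is)
  facts with upTo N
  ... | l = refl , refl , λ _ _ → refl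

rhsSum≡Σ : ∀ N → rhsSum N ≡ - Σ N (rhsTerm N ∘ suc)
rhsSum≡Σ N = trans (rhsSum-unfold N)
  (trans (Σ-cong N (λ i _ → ring (sgn (suc i)) (weight (suc i)) (p₂ (+ N - + tri (suc i))))) (Σ-neg N (rhsTerm N ∘ suc)))
  where
  ring : ∀ s w p → - + 1 * s * w * p ≡ - (w * (s * p))
  ring = solve-∀

tri≡triangular : ∀ k → tri k ≡ triangular k
tri≡triangular k = trans (cong (_/ 2) (sym (triangular-double k))) (m*n/n≡m (triangular k) 2)

jacobiFactor-at-partitions : ∀ N k → k ≤ N →
  jacobiFactor N k (waysSeries (colouredParts 2 N)) (+ N - + triangular k) ≡ p₂ (+ N - + tri k)
jacobiFactor-at-partitions N k k≤N rewrite tri≡triangular k with triangular k ≤? N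
... | yes t≤N rewrite trans (ℤP.m-n≡m⊖n N (triangular k)) (ℤP.⊖-≥ t≤N) =
  trans (∇∏-range-below (∇∏-PowerSeries (range (suc N ℕ.+ suc k) (N ∸ k)) W₊) (suc N ∸ k) k q<1+N-k)
        (trans (∇∏-range-below W₊ (suc N ℕ.+ suc k) (N ∸ k) q<2+N+k)
               (waysSeries-p₂ N (N ∸ triangular k) (ℕP.m∸n≤m N (triangular k))))
  where
  W₊ : PowerSeries (waysSeries (colouredParts 2 N))
  W₊ _ = refl
  q+k≤N : N ∸ triangular k ℕ.+ k ≤ N
  q+k≤N = subst (N ∸ triangular k ℕ.+ k ≤_) (ℕP.m∸n+n≡m t≤N) (ℕP.+-monoʳ-≤ (N ∸ triangular k) (triangular-≥ k))
  q<1+N-k : N ∸ triangular k < suc N ∸ k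
  q<1+N-k = subst (_< suc N ∸ k) (ℕP.m+n∸n≡m (N ∸ triangular k) k) (ℕP.∸-monoˡ-< (s≤s q+k≤N) (ℕP.m≤n+m k _))
  q<2+N+k : N ∸ triangular k < suc N ℕ.+ suc k
  q<2+N+k = s≤s (ℕP.≤-trans (ℕP.m∸n≤m N (triangular k)) (ℕP.m≤m+n N (suc k)))
... | no t≰N = trans (PowerSeries-below {F} F₊ N<t) (sym (PowerSeries-below {p₂} (λ _ → refl) N<t))
  where
  N<t = ℕP.≰⇒> t≰N
  F = jacobiFactor N k (waysSeries (colouredParts 2 N))
  F₊ : PowerSeries F
  F₊ = ∇∏-PowerSeries (range (suc N ∸ k) k) (∇∏-PowerSeries (range (suc N ℕ.+ suc k) (N ∸ k)) (λ _ → refl))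

jacobiSum-partitions : ∀ N → jacobiSum N (waysSeries (colouredParts 2 N)) (+ N) ≡ Σ (suc N) (rhsTerm N)
jacobiSum-partitions N =
  Σ-cong (suc N) (λ k k<1+N → cong (λ z → weight k * (sgn k * z)) (jacobiFactor-at-partitions N k (ℕP.≤-pred k<1+N)))

jacobiSum-partitions≡pochhammer : ∀ N → jacobiSum N (waysSeries (colouredParts 2 N)) (+ N) ≡ pochhammer N δ (+ N)
jacobiSum-partitions≡pochhammer N = trans (jacobi N W (+ N)) (∇∏-cong (range 1 N) cancel (+ N))
  where
  W = waysSeries (colouredParts 2 N)
  cancel : pochhammer N (pochhammer N W) ≗ δ
  cancel = ≗-trans (pochhammer²-colouredParts N W) (∇∏-waysSeries (colouredParts 2 N) (colouredParts-positive N))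

pochhammer-δ : ∀ N → pochhammer N δ (+ N) ≡ pentagonalSum N δ (+ N)
pochhammer-δ N = trans (sym shanks-at-N) (shanks N δ (+ N))
  where
  open ≡-Reasoning
  first : shanksTerm N 0 δ (+ N) ≡ pochhammer N δ (+ N)
  first = trans (ℤP.*-identityˡ _)
    (trans (cong (λ c → pochhammer N δ (+ N - + c)) (trans (ℕP.+-identityʳ (N ℕ.* 0)) (ℕP.*-zeroʳ N))) (at-0 (pochhammer N δ) (+ N)))
  rest : ∀ k → shanksTerm N (suc k) δ (+ N) ≡ + 0
  rest k = trans (cong (sgn (suc k) *_) (PowerSeries-below {∇∏ (range (suc (suc k)) (N ∸ suc k)) δ}
                                          (∇∏-PowerSeries (range (suc (suc k)) (N ∸ suc k)) {δ} (λ _ → refl)) N<c))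
                 (ℤP.*-zeroʳ (sgn (suc k)))
    where
    N<c : N < N ℕ.* suc k ℕ.+ triangular (suc k)
    N<c = ℕP.≤-<-trans (ℕP.m≤m*n N (suc k)) (ℕP.m<m+n _ (ℕP.<-≤-trans (s≤s z≤n) (ℕP.m≤n+m (suc k) (triangular k))))
  shanks-at-N : shanksSum N δ (+ N) ≡ pochhammer N δ (+ N)
  shanks-at-N = begin
    shanksSum N δ (+ N)                                                ≡⟨ Σ-suc N _ ⟩
    shanksTerm N 0 δ (+ N) + Σ N (λ k → shanksTerm N (suc k) δ (+ N))  ≡⟨ cong₂ _+_ first (Σ-zero N _ rest) ⟩
    pochhammer N δ (+ N) + + 0                                         ≡⟨ ℤP.+-identityʳ _ ⟩
    pochhammer N δ (+ N)                                               ∎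

p₂-recurrence : ∀ N → p₂ (+ N) ≡ pentagonalSum N δ (+ N) + rhsSum N
p₂-recurrence N = begin
  p₂ (+ N)                                                     ≡⟨ trans (ring₁ (p₂ (+ N - + 0))) (at-0 p₂ (+ N)) ⟨
  rhsTerm N 0                                                  ≡⟨ ring₂ (rhsTerm N 0) (Σ N (rhsTerm N ∘ suc)) ⟩
  rhsTerm N 0 + Σ N (rhsTerm N ∘ suc) - Σ N (rhsTerm N ∘ suc)  ≡⟨ cong₂ _+_ (Σ-suc N (rhsTerm N)) (rhsSum≡Σ N) ⟨
  Σ (suc N) (rhsTerm N) + rhsSum N                             ≡⟨ cong (_+ rhsSum N) jacobi-at-N ⟩
  pentagonalSum N δ (+ N) + rhsSum N                           ∎
  where
  open ≡-Reasoning
  ring₁ : ∀ x → + 1 * (+ 1 * x) ≡ x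
  ring₁ = solve-∀
  ring₂ : ∀ a b → a ≡ a + b - b
  ring₂ = solve-∀
  jacobi-at-N : Σ (suc N) (rhsTerm N) ≡ pentagonalSum N δ (+ N)
  jacobi-at-N = trans (sym (jacobiSum-partitions N)) (trans (jacobiSum-partitions≡pochhammer N) (pochhammer-δ N))

theorem1p1 : (n : ℕ) → ((j : ℤ) → suc n ≡ pent j → p₂ (+ suc n) ≡ sgn ∣ j ∣ + rhsSum (suc n))
    × (¬ (∃ λ (j : ℤ) → suc n ≡ pent j) → p₂ (+ suc n) ≡ rhsSum (suc n))
theorem1p1 n = at-pentagonal , non-pentagonal
  where
  at-pentagonal : (j : ℤ) → suc n ≡ pent j → p₂ (+ suc n) ≡ sgn ∣ j ∣ + rhsSum (suc n)
  at-pentagonal j 1+n≡w = trans (p₂-recurrence (suc n)) (cong (_+ rhsSum (suc n))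
    (trans (cong (λ N → pentagonalSum (suc n) δ (+ N)) 1+n≡w)
           (pentagonalSum-δ-on (suc n) j (subst (∣ j ∣ ≤_) (sym 1+n≡w) (∣j∣≤pent j)))))
  non-pentagonal : ¬ (∃ λ (j : ℤ) → suc n ≡ pent j) → p₂ (+ suc n) ≡ rhsSum (suc n)
  non-pentagonal ∄j = trans (p₂-recurrence (suc n))
    (trans (cong (_+ rhsSum (suc n)) (pentagonalSum-δ-off (suc n) (suc n) (λ j _ 1+n≡w → ∄j (j , 1+n≡w))))
           (ℤP.+-identityˡ (rhsSum (suc n))))
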